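{- The following degree sequences are not forcibly self-complementary, where $n$ denotes the number of entries of the sequence: (i) $((2k)^{4k+1})$, where $k\ge 2$; (ii) $(d^{2k},(n-1-d)^{2k})$ (so $n=4k$), where $k\ge2$ and $d\ne 5$; (iii) $(d^{2k_1},(d-1)^{2k_2},(n-d)^{2k_2},(n-1-d)^{2k_1})$ (so $n=4(k_1+k_2)$), where $k_1,k_2>0$.
   Context: Graphs are finite and simple; a graph is self-complementary if it is isomorphic to its complement. A degree sequence is the non-increasing list of vertex degrees of some graph, written compactly as $(d_1^{n_1},\dots,d_\ell^{n_\ell})$ with $d_1>d_2>\dots>d_\ell$ (so the degree values listed are strictly decreasing), meaning $n_i$ entries equal to $d_i$. A realization of a degree sequence is a graph with that degree sequence; a degree sequence is forcibly self-complementary if every realization of it is self-complementary. -}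

module Defs where

open import Data.Nat using (ℕ; zero; suc)
open import Data.Bool using (Bool; true; false; not; if_then_else_)
open import Data.Fin using (Fin)
open import Data.Fin.Permutation using (Permutation′; _⟨$⟩ʳ_)
open import Data.List using (List; length; replicate; map; allFin; lookup)
open import Data.Nat.ListAction using (sum)
open import Data.Product using (Σ; _×_)
open import Relation.Binary.PropositionalEquality using (_≡_; _≢_)
open import Relation.Nullary using (¬_)
open import Data.Fin using (_≟_)
open import Relation.Nullary.Decidable using (does)

record Graph (n : ℕ) : Set where
  field
    adj    : Fin n → Fin n → Bool
    sym    : ∀ i j → adj i j ≡ adj j i
    irrefl : ∀ i → adj i i ≡ false
open Graph public

complement : ∀ {n} → Graph n → Graph n
complement {n} G = record
  { adj    = cadj
  ; sym    = csym
  ; irrefl = cirr }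
  where
  cadj : Fin n → Fin n → Bool
  cadj i j = if does (i ≟ j) then false else not (adj G i j)
  csym : ∀ i j → cadj i j ≡ cadj j i
  csym i j with i ≟ j | j ≟ i
  ... | Relation.Nullary.yes _ | Relation.Nullary.yes _ = _≡_.refl
  ... | Relation.Nullary.yes p | Relation.Nullary.no q = Data.Empty.⊥-elim (q (Relation.Binary.PropositionalEquality.sym p))
    where import Data.Empty
  ... | Relation.Nullary.no q | Relation.Nullary.yes p = Data.Empty.⊥-elim (q (Relation.Binary.PropositionalEquality.sym p))
    where import Data.Empty
  ... | Relation.Nullary.no _ | Relation.Nullary.no _ rewrite sym G i j = _≡_.refl
  cirr : ∀ i → cadj i i ≡ false
  cirr i with i ≟ i
  ... | Relation.Nullary.yes _ = _≡_.refl
  ... | Relation.Nullary.no q = Data.Empty.⊥-elim (q _≡_.refl)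
    where import Data.Empty

Isomorphic : ∀ {n} → Graph n → Graph n → Set
Isomorphic {n} G H =
  Σ (Permutation′ n) λ σ → ∀ i j → adj H (σ ⟨$⟩ʳ i) (σ ⟨$⟩ʳ j) ≡ adj G i j

SelfComplementary : ∀ {n} → Graph n → Set
SelfComplementary G = Isomorphic G (complement G)

degree : ∀ {n} → Graph n → Fin n → ℕ
degree {n} G i = sum (map (λ j → if adj G i j then 1 else 0) (allFin n))

Realizes : (s : List ℕ) → Graph (length s) → Set
Realizes s G =
  Σ (Permutation′ (length s)) λ π → ∀ i → degree G (π ⟨$⟩ʳ i) ≡ lookup s i

IsDegreeSequence : List ℕ → Set
IsDegreeSequence s = Σ (Graph (length s)) λ G → Realizes s G

ForciblySelfComplementary : List ℕ → Set
ForciblySelfComplementary s =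
  ∀ (G : Graph (length s)) → Realizes s G → SelfComplementary G

_^^_ : ℕ → ℕ → List ℕ
d ^^ m = replicate m d
infix 8 _^^_

{-# OPTIONS --safe #-}
module Submission where

-- An isomorphism σ from G onto its complement negates adjacency between distinct
-- vertices and sends degree δ to n − 1 − δ, so it suffices to realize each sequence
-- by a graph with a property that cannot survive this.
-- (i) K_{2k,2k} minus a k-edge matching, plus an apex joined to the 2k matched
--     vertices, is 2k-regular; one vertex v has an independent neighbourhood, yet
--     every vertex lies in an independent triple, and σ pulls the triple at σ(v)
--     back to a triangle through v.
-- (ii), (iii) With m = k resp. k₁ + k₂, the Erdős–Gallai inequality for the 2m
--     largest entries forces d = 2m + s with m = s + 1 + z.  A circulant-type
--     realization makes the 2m high vertices pairwise adjacent and contains an edge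
--     between low vertices unless z = 0 in (ii); σ⁻¹ would map that edge into the
--     clique.  For z = 0 in (ii) the realization used instead has two twin high
--     vertices but no twin low vertices, which needs k ≥ 3, i.e. d ≠ 5.

open import Data.Bool using (Bool; true; false; if_then_else_; not; _∧_; _∨_)
open import Data.Bool.Properties using (not-involutive; ∨-identityʳ; ∨-comm; ∧-zeroʳ)
open import Data.Empty using (⊥-elim)
open import Data.Fin as Fin using (Fin; toℕ; fromℕ<)
import Data.Fin.Properties as Fin
open import Data.Fin.Permutation using (Permutation′; _⟨$⟩ʳ_; _⟨$⟩ˡ_; inverseʳ; inverseˡ)
import Data.Fin.Permutation as Perm
open import Data.List using (List; []; _∷_; _++_; length; map; replicate; allFin; tabulate; lookup)
open import Data.List.Properties using (map-tabulate; length-++; length-replicate; ++-assoc)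
open import Data.Nat
open import Data.Nat.DivMod
open import Data.Nat.ListAction using (sum)
open import Data.Nat.ListAction.Properties using (sum-++)
open import Data.Nat.Properties
open import Data.Nat.Solver using (module +-*-Solver)
open import Data.Product using (∃; _×_; _,_; proj₁; proj₂)
open import Data.Sum using (_⊎_; inj₁; inj₂)
open import Function using (_∘_)
open import Relation.Binary using (tri<; tri≈; tri>)
open import Relation.Binary.PropositionalEquality
open import Relation.Nullary using (¬_; Dec; yes; no; does)
open import Relation.Nullary.Decidable using (dec-true; dec-false)

open import Algebra.Properties.CommutativeSemigroup +-commutativeSemigroup using (interchange)
import Algebra.Properties.CommutativeMonoid.Sum +-0-commutativeMonoid as Fin∑
open +-*-Solver using (solve; _:+_; _:*_; con; _:=_)

open import Defs hiding (sym)

-- Sums over initial segments of ℕ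

ind : Bool → ℕ
ind b = if b then 1 else 0

ind≤1 : ∀ b → ind b ≤ 1
ind≤1 true  = ≤-refl
ind≤1 false = z≤n

∑< : ℕ → (ℕ → ℕ) → ℕ
∑< zero    f = 0
∑< (suc n) f = f 0 + ∑< n (f ∘ suc)

syntax ∑< n (λ y → e) = ∑[ y < n ] e

∑<-cong : ∀ n {f g : ℕ → ℕ} → (∀ y → y < n → f y ≡ g y) → ∑< n f ≡ ∑< n g
∑<-cong zero    eq = refl
∑<-cong (suc n) eq = cong₂ _+_ (eq 0 z<s) (∑<-cong n (λ y y<n → eq (suc y) (s<s y<n)))

∑<-+ : ∀ m n (f : ℕ → ℕ) → ∑< (m + n) f ≡ ∑< m f + ∑[ y < n ] f (m + y)
∑<-+ zero    n f = refl
∑<-+ (suc m) n f = trans (cong (f 0 +_) (∑<-+ m n (f ∘ suc))) (sym (+-assoc (f 0) _ _))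

∑<-distrib : ∀ n (f g : ℕ → ℕ) → ∑[ y < n ] (f y + g y) ≡ ∑< n f + ∑< n g
∑<-distrib zero    f g = refl
∑<-distrib (suc n) f g =
  trans (cong (f 0 + g 0 +_) (∑<-distrib n (f ∘ suc) (g ∘ suc))) (interchange (f 0) (g 0) _ _)

∑<-const : ∀ n c → ∑[ y < n ] c ≡ n * c
∑<-const zero    c = refl
∑<-const (suc n) c = cong (c +_) (∑<-const n c)

∑<-mono : ∀ n {f g : ℕ → ℕ} → (∀ y → y < n → f y ≤ g y) → ∑< n f ≤ ∑< n g
∑<-mono zero    le = z≤n
∑<-mono (suc n) le = +-mono-≤ (le 0 z<s) (∑<-mono n (λ y y<n → le (suc y) (s<s y<n)))

∑<-comm : ∀ m n (h : ℕ → ℕ → ℕ) → ∑[ x < m ] ∑[ y < n ] h x y ≡ ∑[ y < n ] ∑[ x < m ] h x y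
∑<-comm zero    n h = sym (trans (∑<-const n 0) (*-zeroʳ n))
∑<-comm (suc m) n h =
  trans (cong (∑< n (h 0) +_) (∑<-comm m n (h ∘ suc))) (sym (∑<-distrib n (h 0) _))

∑<-zero : ∀ n {f : ℕ → ℕ} → (∀ y → y < n → f y ≡ 0) → ∑< n f ≡ 0
∑<-zero n f≡0 = trans (∑<-cong n f≡0) (trans (∑<-const n 0) (*-zeroʳ n))

∑<-one : ∀ n {f : ℕ → ℕ} → (∀ y → y < n → f y ≡ 1) → ∑< n f ≡ n
∑<-one n f≡1 = trans (∑<-cong n f≡1) (trans (∑<-const n 1) (*-identityʳ n))

∑<-single : ∀ {n c} (f : ℕ → ℕ) → c < n → (∀ y → y < n → y ≢ c → f y ≡ 0) → ∑< n f ≡ f c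
∑<-single {n} {c} f c<n f≡0 = begin
  ∑< n f                                         ≡⟨ cong (λ m → ∑< m f) (trans (+-suc c r) (m+[n∸m]≡n c<n)) ⟨
  ∑< (c + suc r) f                               ≡⟨ ∑<-+ c (suc r) f ⟩
  ∑< c f + (f (c + 0) + ∑[ y < r ] f (c + suc y))
    ≡⟨ cong₂ (λ x c′ → x + (f c′ + ∑[ y < r ] f (c + suc y))) (∑<-zero c (λ y y<c → f≡0 y (<-trans y<c c<n) (<⇒≢ y<c))) (+-identityʳ c) ⟩
  f c + ∑[ y < r ] f (c + suc y)                 ≡⟨ cong (f c +_) (∑<-zero r (λ y y<r → f≡0 _ (below y<r) (m+1+n≢m c))) ⟩
  f c + 0                                        ≡⟨ +-identityʳ (f c) ⟩
  f c                                            ∎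
  where
  open ≡-Reasoning
  r = n ∸ suc c
  below : ∀ {y} → y < r → c + suc y < n
  below {y} y<r = subst (c + suc y <_) (trans (+-suc c r) (m+[n∸m]≡n c<n)) (+-monoʳ-< c (s≤s y<r))

∑<-≤-extend : ∀ {p n} (f : ℕ → ℕ) → p ≤ n → ∑< p f ≤ ∑< n f
∑<-≤-extend {p} {n} f p≤n = begin
  ∑< p f                              ≤⟨ m≤m+n _ _ ⟩
  ∑< p f + ∑[ y < n ∸ p ] f (p + y)   ≡⟨ ∑<-+ p (n ∸ p) f ⟨
  ∑< (p + (n ∸ p)) f                  ≡⟨ cong (λ m → ∑< m f) (m+[n∸m]≡n p≤n) ⟩
  ∑< n f                              ∎
  where open ≤-Reasoning

∑<-≤-* : ∀ n {f : ℕ → ℕ} {c} → (∀ y → y < n → f y ≤ c) → ∑< n f ≤ n * c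
∑<-≤-* n {c = c} f≤c = subst (_ ≤_) (∑<-const n c) (∑<-mono n f≤c)

∑<-≤-pred : ∀ {p a} (f : ℕ → ℕ) → a < p → (∀ y → f y ≤ 1) → f a ≡ 0 → ∑< p f ≤ p ∸ 1
∑<-≤-pred {p} {a} f a<p f≤1 fa≡0 = begin
  ∑< p f                                                  ≡⟨ cong (λ m → ∑< m f) p≡a+1+r ⟨
  ∑< (a + suc r) f                                        ≡⟨ ∑<-+ a (suc r) f ⟩
  ∑< a f + (f (a + 0) + ∑[ y < r ] f (a + suc y))         ≤⟨ +-mono-≤ (∑<-≤-* a (λ y _ → f≤1 y))
                                                             (+-mono-≤ (≤-reflexive (trans (cong f (+-identityʳ a)) fa≡0))
                                                                       (∑<-≤-* r (λ y _ → f≤1 (a + suc y)))) ⟩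
  a * 1 + (0 + r * 1)                                     ≡⟨ cong₂ (λ x y → x + y) (*-identityʳ a) (*-identityʳ r) ⟩
  a + r                                                   ≡⟨ cong (_∸ 1) (+-suc a r) ⟨
  a + suc r ∸ 1                                           ≡⟨ cong (_∸ 1) p≡a+1+r ⟩
  p ∸ 1                                                   ∎
  where
  open ≤-Reasoning
  r = p ∸ suc a
  p≡a+1+r : a + suc r ≡ p
  p≡a+1+r = trans (+-suc a r) (m+[n∸m]≡n a<p)

∑<-reverse : ∀ n (f : ℕ → ℕ) → ∑[ y < n ] f (n ∸ suc y) ≡ ∑< n f
∑<-reverse zero    f = refl
∑<-reverse (suc n) f = begin
  f n + ∑[ y < n ] f (n ∸ suc y)    ≡⟨ cong (f n +_) (∑<-reverse n f) ⟩
  f n + ∑< n f                      ≡⟨ +-comm (f n) _ ⟩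
  ∑< n f + f n                      ≡⟨ cong (λ x → ∑< n f + f x) (+-identityʳ n) ⟨
  ∑< n f + f (n + 0)                ≡⟨ cong (∑< n f +_) (+-identityʳ _) ⟨
  ∑< n f + ∑[ y < 1 ] f (n + y)     ≡⟨ ∑<-+ n 1 f ⟨
  ∑< (n + 1) f                      ≡⟨ cong (λ m → ∑< m f) (+-comm n 1) ⟩
  ∑< (suc n) f                      ∎
  where open ≡-Reasoning

does-true : ∀ {P : Set} (P? : Dec P) → does P? ≡ true → P
does-true (yes p) _ = p

≟-sym : ∀ x y → does (x ≟ y) ≡ does (y ≟ x)
≟-sym x y with x ≟ y
... | yes x≡y rewrite dec-true (x ≟ y) x≡y | dec-true (y ≟ x) (sym x≡y) = refl
... | no  x≢y rewrite dec-false (x ≟ y) x≢y | dec-false (y ≟ x) (x≢y ∘ sym) = refl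

ind-∨ : ∀ x y → (x ≡ true → y ≡ false) → ind (x ∨ y) ≡ ind x + ind y
ind-∨ true  y x⇒¬y = sym (cong (λ w → 1 + ind w) (x⇒¬y refl))
ind-∨ false y _    = refl

ind-<-+ind : ∀ x t b → ind (does (x <? t + ind b)) ≡ ind (does (x <? t)) + ind (does (x ≟ t) ∧ b)
ind-<-+ind x t false rewrite +-identityʳ t | ∧-zeroʳ (does (x ≟ t)) = sym (+-identityʳ _)
ind-<-+ind x t true with <-cmp x t
... | tri< x<t x≢t _
  rewrite dec-true (x <? t + 1) (m≤n⇒m≤n+o 1 x<t) | dec-true (x <? t) x<t | dec-false (x ≟ t) x≢t = refl
... | tri≈ x≮t x≡t _
  rewrite dec-true (x <? t + 1) (subst (_< t + 1) (sym x≡t) (m<m+n t z<s)) | dec-false (x <? t) x≮t | dec-true (x ≟ t) x≡t = refl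
... | tri> x≮t x≢t t<x
  rewrite dec-false (x <? t + 1) (≤⇒≯ (subst (_≤ x) (+-comm 1 t) t<x)) | dec-false (x <? t) x≮t | dec-false (x ≟ t) x≢t = refl

∑<-point : ∀ {n c} (P : ℕ → Bool) → c < n → ∑[ y < n ] ind (does (y ≟ c) ∧ P y) ≡ ind (P c)
∑<-point {c = c} P c<n = trans (∑<-single _ c<n (λ y _ y≢c → cong (λ b → ind (b ∧ P y)) (dec-false (y ≟ c) y≢c)))
                               (cong (λ b → ind (b ∧ P c)) (dec-true (c ≟ c) refl))

∑<-≟ : ∀ {n c} → c < n → ∑[ y < n ] ind (does (c ≟ y)) ≡ 1
∑<-≟ {c = c} c<n =
  trans (∑<-single _ c<n (λ y _ y≢c → cong ind (dec-false (c ≟ y) (y≢c ∘ sym)))) (cong ind (dec-true (c ≟ c) refl))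

∑<-not : ∀ n (P : ℕ → Bool) → ∑[ y < n ] ind (not (P y)) + ∑[ y < n ] ind (P y) ≡ n
∑<-not n P = trans (sym (∑<-distrib n _ _)) (∑<-one n (λ y _ → ind-not (P y)))
  where
  ind-not : ∀ b → ind (not b) + ind b ≡ 1
  ind-not true  = refl
  ind-not false = refl

∑<-≢ : ∀ {n c} → c < n → ∑[ y < n ] ind (not (does (c ≟ y))) + 1 ≡ n
∑<-≢ {n} {c} c<n =
  trans (cong (∑[ y < n ] ind (not (does (c ≟ y))) +_) (sym (∑<-≟ c<n))) (∑<-not n (λ y → does (c ≟ y)))

∑<-lt : ∀ {n b} → b ≤ n → ∑[ y < n ] ind (does (y <? b)) ≡ b
∑<-lt {n} {b} b≤n = begin
  ∑[ y < n ] ind (does (y <? b))                                        ≡⟨ cong (λ m → ∑[ y < m ] ind (does (y <? b))) (m+[n∸m]≡n b≤n) ⟨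
  ∑[ y < b + (n ∸ b) ] ind (does (y <? b))                              ≡⟨ ∑<-+ b (n ∸ b) _ ⟩
  ∑[ y < b ] ind (does (y <? b)) + ∑[ y < n ∸ b ] ind (does (b + y <? b))
    ≡⟨ cong₂ _+_ (∑<-one b (λ y y<b → cong ind (dec-true (y <? b) y<b)))
                 (∑<-zero (n ∸ b) (λ y _ → cong ind (dec-false (b + y <? b) (m+n≮m b y)))) ⟩
  b + 0                                                                 ≡⟨ +-identityʳ b ⟩
  b                                                                     ∎
  where open ≡-Reasoning

∑<-if : ∀ k m (P Q : ℕ → Bool) →
  ∑[ y < k + m ] ind (if does (y <? k) then P y else Q (y ∸ k)) ≡ ∑[ y < k ] ind (P y) + ∑[ y < m ] ind (Q y)
∑<-if k m P Q = trans (∑<-+ k m _) (cong₂ _+_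
  (∑<-cong k (λ y y<k → cong (λ b → ind (if b then P y else Q (y ∸ k))) (dec-true (y <? k) y<k)))
  (∑<-cong m (λ y _ → cong₂ (λ b x → ind (if b then P (k + y) else Q x)) (dec-false (k + y <? k) (m+n≮m k y)) (m+n∸m≡n k y))))

-- Rotations modulo N

module Modular (N : ℕ) .{{_ : NonZero N}} where

  %-absorbˡ : ∀ a b → (a % N + b) % N ≡ (a + b) % N
  %-absorbˡ a b = begin
    (a % N + b) % N          ≡⟨ %-distribˡ-+ (a % N) b N ⟩
    (a % N % N + b % N) % N  ≡⟨ cong (λ x → (x + b % N) % N) (m%n%n≡m%n a N) ⟩
    (a % N + b % N) % N      ≡⟨ %-distribˡ-+ a b N ⟨
    (a + b) % N              ∎
    where open ≡-Reasoning

  %-unrotate : ∀ a c → ((a + c) % N + (N ∸ c % N)) % N ≡ a % N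
  %-unrotate a c = begin
    ((a + c) % N + (N ∸ r)) % N          ≡⟨ %-absorbˡ (a + c) (N ∸ r) ⟩
    (a + c + (N ∸ r)) % N                ≡⟨ cong (λ x → (a + x + (N ∸ r)) % N) (m≡m%n+[m/n]*n c N) ⟩
    (a + (r + q * N) + (N ∸ r)) % N
      ≡⟨ cong (_% N) (solve 4 (λ a r qN t → a :+ (r :+ qN) :+ t := a :+ qN :+ (r :+ t)) refl a r (q * N) (N ∸ r)) ⟩
    (a + q * N + (r + (N ∸ r))) % N      ≡⟨ cong (λ x → (a + q * N + x) % N) (m+[n∸m]≡n (m%n≤n c N)) ⟩
    (a + q * N + N) % N                  ≡⟨ cong (_% N) (+-assoc a (q * N) N) ⟩
    (a + (q * N + N)) % N                ≡⟨ cong (λ x → (a + x) % N) (+-comm (q * N) N) ⟩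
    (a + suc q * N) % N                  ≡⟨ [m+kn]%n≡m%n a (suc q) N ⟩
    a % N                                ∎
    where
    open ≡-Reasoning
    r = c % N
    q = c / N

  rotate-injective : ∀ c {y y′} → y < N → y′ < N → (y + c) % N ≡ (y′ + c) % N → y ≡ y′
  rotate-injective c {y} {y′} y<N y′<N eq = begin
    y                                    ≡⟨ m<n⇒m%n≡m y<N ⟨
    y % N                                ≡⟨ %-unrotate y c ⟨
    ((y + c) % N + (N ∸ c % N)) % N      ≡⟨ cong (λ x → (x + (N ∸ c % N)) % N) eq ⟩
    ((y′ + c) % N + (N ∸ c % N)) % N     ≡⟨ %-unrotate y′ c ⟩
    y′ % N                               ≡⟨ m<n⇒m%n≡m y′<N ⟩
    y′                                   ∎
    where open ≡-Reasoning

  ∑-rotate≤ : ∀ {r} (f : ℕ → ℕ) → r ≤ N → ∑[ y < N ] f ((y + r) % N) ≡ ∑< N f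
  ∑-rotate≤ {r} f r≤N = begin
    ∑[ y < N ] f ((y + r) % N)                            ≡⟨ cong (λ m → ∑[ y < m ] f ((y + r) % N)) (m∸n+n≡m r≤N) ⟨
    ∑[ y < N ∸ r + r ] f ((y + r) % N)                    ≡⟨ ∑<-+ (N ∸ r) r _ ⟩
    ∑[ y < N ∸ r ] f ((y + r) % N) + ∑[ t < r ] f ((N ∸ r + t + r) % N)
      ≡⟨ cong₂ _+_ (∑<-cong (N ∸ r) (λ y y<N∸r → cong f (m<n⇒m%n≡m (below y<N∸r))))
                   (∑<-cong r (λ t t<r → cong f (wrap t<r))) ⟩
    ∑[ y < N ∸ r ] f (y + r) + ∑< r f                      ≡⟨ +-comm _ (∑< r f) ⟩
    ∑< r f + ∑[ y < N ∸ r ] f (y + r)                      ≡⟨ cong (∑< r f +_) (∑<-cong (N ∸ r) (λ y _ → cong f (+-comm y r))) ⟩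
    ∑< r f + ∑[ y < N ∸ r ] f (r + y)                      ≡⟨ ∑<-+ r (N ∸ r) f ⟨
    ∑< (r + (N ∸ r)) f                                    ≡⟨ cong (λ m → ∑< m f) (m+[n∸m]≡n r≤N) ⟩
    ∑< N f                                                ∎
    where
    open ≡-Reasoning
    below : ∀ {y} → y < N ∸ r → y + r < N
    below {y} y<N∸r = subst (y + r <_) (m∸n+n≡m r≤N) (+-monoˡ-< r y<N∸r)
    wrap : ∀ {t} → t < r → (N ∸ r + t + r) % N ≡ t
    wrap {t} t<r = begin
      (N ∸ r + t + r) % N    ≡⟨ cong (_% N) (solve 3 (λ u t r → u :+ t :+ r := t :+ (u :+ r)) refl (N ∸ r) t r) ⟩
      (t + (N ∸ r + r)) % N  ≡⟨ cong (λ x → (t + x) % N) (m∸n+n≡m r≤N) ⟩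
      (t + N) % N            ≡⟨ [m+n]%n≡m%n t N ⟩
      t % N                  ≡⟨ m<n⇒m%n≡m (<-≤-trans t<r r≤N) ⟩
      t                      ∎

  ∑-rotate : ∀ c (f : ℕ → ℕ) → ∑[ y < N ] f ((y + c) % N) ≡ ∑< N f
  ∑-rotate c f = trans (∑<-cong N (λ y _ → cong f (reduce y))) (∑-rotate≤ f (m%n≤n c N))
    where
    reduce : ∀ y → (y + c) % N ≡ (y + c % N) % N
    reduce y = trans (cong (_% N) (+-comm y c)) (trans (sym (%-absorbˡ c y)) (cong (_% N) (+-comm (c % N) y)))

  ∑-rotate-point : ∀ c {y₀ t} (P : ℕ → Bool) → y₀ < N → (y₀ + c) % N ≡ t →
                   ∑[ y < N ] ind (does ((y + c) % N ≟ t) ∧ P y) ≡ ind (P y₀)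
  ∑-rotate-point c {y₀} {t} P y₀<N y₀↦t = trans
    (∑<-single _ y₀<N (λ y y<N y≢y₀ → cong (λ b → ind (b ∧ P y))
      (dec-false ((y + c) % N ≟ t) (λ y↦t → y≢y₀ (rotate-injective c y<N y₀<N (trans y↦t (sym y₀↦t)))))))
    (cong (λ b → ind (b ∧ P y₀)) (dec-true ((y₀ + c) % N ≟ t) y₀↦t))

  ∑-rotate-window : ∀ c t {y₀} (P : ℕ → Bool) → t < N → y₀ < N → (y₀ + c) % N ≡ t →
    ∑[ y < N ] ind (does ((y + c) % N <? t + ind (P y))) ≡ t + ind (P y₀)
  ∑-rotate-window c t {y₀} P t<N y₀<N y₀↦t = begin
    ∑[ y < N ] ind (does ((y + c) % N <? t + ind (P y)))
      ≡⟨ ∑<-cong N (λ y _ → ind-<-+ind ((y + c) % N) t (P y)) ⟩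
    ∑[ y < N ] (ind (does ((y + c) % N <? t)) + ind (does ((y + c) % N ≟ t) ∧ P y))
      ≡⟨ ∑<-distrib N (λ y → ind (does ((y + c) % N <? t))) (λ y → ind (does ((y + c) % N ≟ t) ∧ P y)) ⟩
    ∑[ y < N ] ind (does ((y + c) % N <? t)) + ∑[ y < N ] ind (does ((y + c) % N ≟ t) ∧ P y)
      ≡⟨ cong₂ _+_ (trans (∑-rotate c (λ x → ind (does (x <? t)))) (∑<-lt (<⇒≤ t<N))) (∑-rotate-point c P y₀<N y₀↦t) ⟩
    t + ind (P y₀) ∎
    where open ≡-Reasoning

  %≡0⇒≥ : ∀ {x} → x % N ≡ 0 → 0 < x → N ≤ x
  %≡0⇒≥ {x} x%N≡0 0<x = ≮⇒≥ (λ x<N → <⇒≢ 0<x (sym (trans (sym (m<n⇒m%n≡m x<N)) x%N≡0)))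

sum-allFin : ∀ {n} (f : Fin n → ℕ) → sum (map f (allFin n)) ≡ Fin∑.sum f
sum-allFin {n} f = trans (cong sum (map-tabulate (λ j → j) f)) (sum-tabulate f)
  where
  sum-tabulate : ∀ {m} (g : Fin m → ℕ) → sum (tabulate g) ≡ Fin∑.sum g
  sum-tabulate {zero}  g = refl
  sum-tabulate {suc m} g = cong (g Fin.zero +_) (sum-tabulate (g ∘ Fin.suc))

degree-∑ : ∀ {n} (G : Graph n) i → degree G i ≡ Fin∑.sum (λ j → ind (adj G i j))
degree-∑ G i = sum-allFin (λ j → ind (adj G i j))

Fin∑-toℕ : ∀ n (g : ℕ → ℕ) → Fin∑.sum {n} (g ∘ toℕ) ≡ ∑< n g
Fin∑-toℕ zero    g = refl
Fin∑-toℕ (suc n) g = cong (g 0 +_) (Fin∑-toℕ n (g ∘ suc))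

Fin∑-point : ∀ {n} (u : Fin n) → Fin∑.sum (λ j → ind (does (u Fin.≟ j))) ≡ 1
Fin∑-point {suc n} Fin.zero    = cong suc (Fin∑.sum-replicate-zero n)
Fin∑-point {suc n} (Fin.suc u) = Fin∑-point u

module _ {n} (G : Graph n) where

  complement-adj : ∀ {u v} → u ≢ v → adj (complement G) u v ≡ not (adj G u v)
  complement-adj {u} {v} u≢v rewrite dec-false (u Fin.≟ v) u≢v = refl

  complement-degree : ∀ u → degree (complement G) u + degree G u + 1 ≡ n
  complement-degree u = begin
    degree (complement G) u + degree G u + 1
      ≡⟨ cong₂ (λ x y → x + y + 1) (degree-∑ (complement G) u) (degree-∑ G u) ⟩
    Fin∑.sum co + Fin∑.sum g + 1
      ≡⟨ cong₂ _+_ (sym (Fin∑.∑-distrib-+ co g)) (sym (Fin∑-point u)) ⟩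
    Fin∑.sum (λ j → co j + g j) + Fin∑.sum (λ j → ind (does (u Fin.≟ j)))
      ≡⟨ sym (Fin∑.∑-distrib-+ (λ j → co j + g j) (λ j → ind (does (u Fin.≟ j)))) ⟩
    Fin∑.sum (λ j → co j + g j + ind (does (u Fin.≟ j)))
      ≡⟨ Fin∑.sum-cong-≗ one ⟩
    Fin∑.sum {n} (λ _ → 1)
      ≡⟨ Fin∑-toℕ n (λ _ → 1) ⟩
    ∑[ _ < n ] 1
      ≡⟨ trans (∑<-const n 1) (*-identityʳ n) ⟩
    n ∎
    where
    open ≡-Reasoning
    co g : Fin n → ℕ
    co j = ind (adj (complement G) u j)
    g  j = ind (adj G u j)
    one : ∀ j → co j + g j + ind (does (u Fin.≟ j)) ≡ 1
    one j with u Fin.≟ j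
    ... | yes refl rewrite irrefl G u = refl
    ... | no _ with adj G u j
    ...   | true  = refl
    ...   | false = refl

degree-iso : ∀ {n} (G H : Graph n) (σ : Permutation′ n) →
             (∀ i j → adj H (σ ⟨$⟩ʳ i) (σ ⟨$⟩ʳ j) ≡ adj G i j) →
             ∀ i → degree H (σ ⟨$⟩ʳ i) ≡ degree G i
degree-iso G H σ iso i = begin
  degree H (σ ⟨$⟩ʳ i)                               ≡⟨ degree-∑ H _ ⟩
  Fin∑.sum (λ j → ind (adj H (σ ⟨$⟩ʳ i) j))         ≡⟨ Fin∑.sum-permute _ σ ⟩
  Fin∑.sum (λ j → ind (adj H (σ ⟨$⟩ʳ i) (σ ⟨$⟩ʳ j))) ≡⟨ Fin∑.sum-cong-≗ (cong ind ∘ iso i) ⟩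
  Fin∑.sum (λ j → ind (adj G i j))                  ≡⟨ degree-∑ G i ⟨
  degree G i ∎
  where open ≡-Reasoning

-- Self-complementary graphs

module SelfComplementarity {n} (G : Graph n) (sc : SelfComplementary G) where

  σ : Permutation′ n
  σ = proj₁ sc

  σ-injective : ∀ {i j} → σ ⟨$⟩ʳ i ≡ σ ⟨$⟩ʳ j → i ≡ j
  σ-injective eq = trans (sym (inverseˡ σ)) (trans (cong (σ ⟨$⟩ˡ_) eq) (inverseˡ σ))

  σ⁻¹-injective : ∀ {u w} → σ ⟨$⟩ˡ u ≡ σ ⟨$⟩ˡ w → u ≡ w
  σ⁻¹-injective eq = trans (sym (inverseʳ σ)) (trans (cong (σ ⟨$⟩ʳ_) eq) (inverseʳ σ))

  σ-flips : ∀ {i j} → i ≢ j → adj G (σ ⟨$⟩ʳ i) (σ ⟨$⟩ʳ j) ≡ not (adj G i j)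
  σ-flips {i} {j} i≢j = begin
    adj G (σ ⟨$⟩ʳ i) (σ ⟨$⟩ʳ j)                    ≡⟨ not-involutive _ ⟨
    not (not (adj G (σ ⟨$⟩ʳ i) (σ ⟨$⟩ʳ j)))        ≡⟨ cong not (complement-adj G (i≢j ∘ σ-injective)) ⟨
    not (adj (complement G) (σ ⟨$⟩ʳ i) (σ ⟨$⟩ʳ j)) ≡⟨ cong not (proj₂ sc i j) ⟩
    not (adj G i j)                                ∎
    where open ≡-Reasoning

  σ⁻¹-flips : ∀ {u w} → u ≢ w → adj G (σ ⟨$⟩ˡ u) (σ ⟨$⟩ˡ w) ≡ not (adj G u w)
  σ⁻¹-flips {u} {w} u≢w = begin
    adj G (σ ⟨$⟩ˡ u) (σ ⟨$⟩ˡ w)                               ≡⟨ not-involutive _ ⟨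
    not (not (adj G (σ ⟨$⟩ˡ u) (σ ⟨$⟩ˡ w)))                   ≡⟨ cong not (σ-flips u≢w′) ⟨
    not (adj G (σ ⟨$⟩ʳ (σ ⟨$⟩ˡ u)) (σ ⟨$⟩ʳ (σ ⟨$⟩ˡ w)))       ≡⟨ cong₂ (λ x y → not (adj G x y)) (inverseʳ σ) (inverseʳ σ) ⟩
    not (adj G u w)                                          ∎
    where
    open ≡-Reasoning
    u≢w′ : σ ⟨$⟩ˡ u ≢ σ ⟨$⟩ˡ w
    u≢w′ = u≢w ∘ σ⁻¹-injective

  σ-degree : ∀ i → degree G i + degree G (σ ⟨$⟩ʳ i) + 1 ≡ n
  σ-degree i = trans (cong (λ x → x + degree G (σ ⟨$⟩ʳ i) + 1) (sym (degree-iso G (complement G) σ (proj₂ sc) i)))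
                     (complement-degree G (σ ⟨$⟩ʳ i))

  σ⁻¹-≢ : ∀ {w x} → w ≢ σ ⟨$⟩ʳ x → σ ⟨$⟩ˡ w ≢ x
  σ⁻¹-≢ w≢σx σ⁻¹w≡x = w≢σx (trans (sym (inverseʳ σ)) (cong (σ ⟨$⟩ʳ_) σ⁻¹w≡x))

  σ⁻¹-degree : ∀ u → degree G (σ ⟨$⟩ˡ u) + degree G u + 1 ≡ n
  σ⁻¹-degree u = trans (cong (λ x → degree G (σ ⟨$⟩ˡ u) + degree G x + 1) (sym (inverseʳ σ))) (σ-degree (σ ⟨$⟩ˡ u))

true≢false : true ≢ false
true≢false ()

adj⇒≢ : ∀ {n} (G : Graph n) {u v} → adj G u v ≡ true → u ≢ v
adj⇒≢ G {u} uv refl = true≢false (trans (sym uv) (irrefl G u))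

Twins : ∀ {n} → Graph n → Fin n → Fin n → Set
Twins G u v = ∀ w → w ≢ u → w ≢ v → adj G u w ≡ adj G v w

IndependentNeighbourhood : ∀ {n} → Graph n → Fin n → Set
IndependentNeighbourhood G v = ∀ a b → adj G v a ≡ true → adj G v b ≡ true → adj G a b ≡ false

InIndependentTriple : ∀ {n} → Graph n → Fin n → Set
InIndependentTriple G u = ∃ λ a → ∃ λ b →
  u ≢ a × u ≢ b × a ≢ b × adj G u a ≡ false × adj G u b ≡ false × adj G a b ≡ false

highClique⇒¬selfComplementary : ∀ {n} (G : Graph n) t →
  (∀ u v → u ≢ v → t ≤ degree G u → t ≤ degree G v → adj G u v ≡ true) →
  ∀ {u v} → adj G u v ≡ true → degree G u + t < n → degree G v + t < n →
  ¬ SelfComplementary G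
highClique⇒¬selfComplementary {n} G t clique {u} {v} uv du dv sc =
  true≢false (trans (sym (clique _ _ (adj⇒≢ G uv ∘ σ⁻¹-injective) (high du) (high dv)))
                    (trans (σ⁻¹-flips (adj⇒≢ G uv)) (cong not uv)))
  where
  open SelfComplementarity G sc
  high : ∀ {w} → degree G w + t < n → t ≤ degree G (σ ⟨$⟩ˡ w)
  high {w} dw = +-cancelˡ-≤ (degree G w) t _ (≤-pred (begin-strict
    degree G w + t                          <⟨ dw ⟩
    n                                       ≡⟨ σ⁻¹-degree w ⟨
    degree G (σ ⟨$⟩ˡ w) + degree G w + 1    ≡⟨ +-comm _ 1 ⟩
    suc (degree G (σ ⟨$⟩ˡ w) + degree G w)  ≡⟨ cong suc (+-comm _ (degree G w)) ⟩
    suc (degree G w + degree G (σ ⟨$⟩ˡ w))  ∎))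
    where open ≤-Reasoning

twins⇒¬selfComplementary : ∀ {n} (G : Graph n) d e → d + e + 1 ≡ n →
  ∀ {u v} → u ≢ v → degree G u ≡ d → degree G v ≡ d → Twins G u v →
  (∀ x y → x ≢ y → degree G x ≡ e → degree G y ≡ e → ¬ Twins G x y) →
  ¬ SelfComplementary G
twins⇒¬selfComplementary {n} G d e d+e+1≡n {u} {v} u≢v du dv uv-twins no-twins sc =
  no-twins (σ ⟨$⟩ʳ u) (σ ⟨$⟩ʳ v) (u≢v ∘ σ-injective) (image du) (image dv) image-twins
  where
  open SelfComplementarity G sc
  image : ∀ {x} → degree G x ≡ d → degree G (σ ⟨$⟩ʳ x) ≡ e
  image {x} dx = +-cancelʳ-≡ 1 _ e (+-cancelˡ-≡ d _ _ (begin
    d + (degree G (σ ⟨$⟩ʳ x) + 1)    ≡⟨ +-assoc d _ 1 ⟨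
    d + degree G (σ ⟨$⟩ʳ x) + 1      ≡⟨ cong (λ y → y + degree G (σ ⟨$⟩ʳ x) + 1) dx ⟨
    degree G x + degree G (σ ⟨$⟩ʳ x) + 1 ≡⟨ σ-degree x ⟩
    n                                ≡⟨ d+e+1≡n ⟨
    d + e + 1                        ≡⟨ +-assoc d e 1 ⟩
    d + (e + 1)                      ∎))
    where open ≡-Reasoning
  image-twins : Twins G (σ ⟨$⟩ʳ u) (σ ⟨$⟩ʳ v)
  image-twins w w≢σu w≢σv = begin
    adj G (σ ⟨$⟩ʳ u) w                   ≡⟨ cong (adj G _) (inverseʳ σ) ⟨
    adj G (σ ⟨$⟩ʳ u) (σ ⟨$⟩ʳ w′)          ≡⟨ σ-flips (σ⁻¹-≢ w≢σu ∘ sym) ⟩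
    not (adj G u w′)                     ≡⟨ cong not (uv-twins w′ (σ⁻¹-≢ w≢σu) (σ⁻¹-≢ w≢σv)) ⟩
    not (adj G v w′)                     ≡⟨ σ-flips (σ⁻¹-≢ w≢σv ∘ sym) ⟨
    adj G (σ ⟨$⟩ʳ v) (σ ⟨$⟩ʳ w′)          ≡⟨ cong (adj G _) (inverseʳ σ) ⟩
    adj G (σ ⟨$⟩ʳ v) w                   ∎
    where
    open ≡-Reasoning
    w′ = σ ⟨$⟩ˡ w

independentNeighbourhood⇒¬selfComplementary : ∀ {n} (G : Graph n) v →
  IndependentNeighbourhood G v → (∀ u → InIndependentTriple G u) → ¬ SelfComplementary G
independentNeighbourhood⇒¬selfComplementary G v independent triples sc
  with triples (proj₁ sc ⟨$⟩ʳ v)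
... | a , b , σv≢a , σv≢b , a≢b , σv-a , σv-b , a-b =
  true≢false (trans (sym (pull a≢b a-b)) (independent _ _ (from-v σv≢a σv-a) (from-v σv≢b σv-b)))
  where
  open SelfComplementarity G sc
  pull : ∀ {x y} → x ≢ y → adj G x y ≡ false → adj G (σ ⟨$⟩ˡ x) (σ ⟨$⟩ˡ y) ≡ true
  pull x≢y xy = trans (σ⁻¹-flips x≢y) (cong not xy)
  from-v : ∀ {y} → σ ⟨$⟩ʳ v ≢ y → adj G (σ ⟨$⟩ʳ v) y ≡ false → adj G v (σ ⟨$⟩ˡ y) ≡ true
  from-v σv≢y σv-y = subst (λ x → adj G x _ ≡ true) (inverseˡ σ) (pull σv≢y σv-y)

-- The Erdős–Gallai inequality

double-counting : ∀ n p (M : ℕ → ℕ → ℕ) → p ≤ n →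
  (∀ a b → M a b ≤ 1) → (∀ a b → M a b ≡ M b a) → (∀ a → M a a ≡ 0) →
  ∑[ a < p ] ∑< n (M a) ≤ p * (p ∸ 1) + ∑[ y < n ∸ p ] ∑< n (M (p + y))
double-counting n p M p≤n M≤1 M-sym M-diag = begin
  ∑[ a < p ] ∑< n (M a)
    ≡⟨ ∑<-cong p (λ a _ → trans (cong (λ m → ∑< m (M a)) (sym (m+[n∸m]≡n p≤n))) (∑<-+ p (n ∸ p) (M a))) ⟩
  ∑[ a < p ] (∑< p (M a) + ∑[ y < n ∸ p ] M a (p + y))
    ≡⟨ ∑<-distrib p _ _ ⟩
  ∑[ a < p ] ∑< p (M a) + ∑[ a < p ] ∑[ y < n ∸ p ] M a (p + y)
    ≤⟨ +-mono-≤ inside (≤-reflexive (∑<-comm p (n ∸ p) (λ a y → M a (p + y)))) ⟩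
  p * (p ∸ 1) + ∑[ y < n ∸ p ] ∑[ a < p ] M a (p + y)
    ≤⟨ +-monoʳ-≤ (p * (p ∸ 1)) (∑<-mono (n ∸ p) (λ y _ → outside y)) ⟩
  p * (p ∸ 1) + ∑[ y < n ∸ p ] ∑< n (M (p + y)) ∎
  where
  open ≤-Reasoning
  inside : ∑[ a < p ] ∑< p (M a) ≤ p * (p ∸ 1)
  inside = ∑<-≤-* p (λ a a<p → ∑<-≤-pred (M a) a<p (M≤1 a) (M-diag a))
  outside : ∀ y → ∑[ a < p ] M a (p + y) ≤ ∑< n (M (p + y))
  outside y = subst (_≤ ∑< n (M (p + y))) (∑<-cong p (λ a _ → M-sym (p + y) a)) (∑<-≤-extend (M (p + y)) p≤n)

module Relabelling {n} (G : Graph n) (π : Permutation′ n) where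

  entry : ∀ {a b} → Dec (a < n) → Dec (b < n) → ℕ
  entry (yes a<n) (yes b<n) = ind (adj G (π ⟨$⟩ʳ fromℕ< a<n) (π ⟨$⟩ʳ fromℕ< b<n))
  entry _         _         = 0

  matrix : ℕ → ℕ → ℕ
  matrix a b = entry (a <? n) (b <? n)

  matrix≤1 : ∀ a b → matrix a b ≤ 1
  matrix≤1 a b with a <? n | b <? n
  ... | yes _ | yes _ = ind≤1 _
  ... | yes _ | no  _ = z≤n
  ... | no  _ | _     = z≤n

  matrix-sym : ∀ a b → matrix a b ≡ matrix b a
  matrix-sym a b with a <? n | b <? n
  ... | yes _ | yes _ = cong ind (Graph.sym G _ _)
  ... | yes _ | no  _ = refl
  ... | no  _ | yes _ = refl
  ... | no  _ | no  _ = refl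

  matrix-diag : ∀ a → matrix a a ≡ 0
  matrix-diag a with a <? n
  ... | yes _ = cong ind (irrefl G _)
  ... | no  _ = refl

  matrix-row : ∀ {a} (a<n : a < n) → ∑< n (matrix a) ≡ degree G (π ⟨$⟩ʳ fromℕ< a<n)
  matrix-row {a} a<n = begin
    ∑< n (matrix a)                                       ≡⟨ Fin∑-toℕ n (matrix a) ⟨
    Fin∑.sum {n} (λ j → matrix a (toℕ j))                 ≡⟨ Fin∑.sum-cong-≗ {n} at-toℕ ⟩
    Fin∑.sum (λ j → ind (adj G (π ⟨$⟩ʳ fromℕ< a<n) (π ⟨$⟩ʳ j))) ≡⟨ Fin∑.sum-permute (λ j → ind (adj G (π ⟨$⟩ʳ fromℕ< a<n) j)) π ⟨
    Fin∑.sum (λ j → ind (adj G (π ⟨$⟩ʳ fromℕ< a<n) j))     ≡⟨ degree-∑ G _ ⟨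
    degree G (π ⟨$⟩ʳ fromℕ< a<n)                           ∎
    where
    open ≡-Reasoning
    at-toℕ : ∀ j → matrix a (toℕ j) ≡ ind (adj G (π ⟨$⟩ʳ fromℕ< a<n) (π ⟨$⟩ʳ j))
    at-toℕ j with a <? n | toℕ j <? n
    ... | yes _   | yes j<n = cong (λ k → ind (adj G _ (π ⟨$⟩ʳ k))) (Fin.fromℕ<-toℕ j j<n)
    ... | yes _   | no  j≮n = ⊥-elim (j≮n (Fin.toℕ<n j))
    ... | no  a≮n | _       = ⊥-elim (a≮n a<n)

at : List ℕ → ℕ → ℕ
at []       _       = 0
at (x ∷ xs) zero    = x
at (x ∷ xs) (suc p) = at xs p

lookup≡at : ∀ s (i : Fin (length s)) → lookup s i ≡ at s (toℕ i)
lookup≡at (x ∷ s) Fin.zero    = refl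
lookup≡at (x ∷ s) (Fin.suc i) = lookup≡at s i

at-++ˡ : ∀ xs ys {p} → p < length xs → at (xs ++ ys) p ≡ at xs p
at-++ˡ (x ∷ xs) ys {zero}  _   = refl
at-++ˡ (x ∷ xs) ys {suc p} p<n = at-++ˡ xs ys (s<s⁻¹ p<n)

at-++ʳ : ∀ xs ys p → at (xs ++ ys) (length xs + p) ≡ at ys p
at-++ʳ []       ys p = refl
at-++ʳ (x ∷ xs) ys p = at-++ʳ xs ys p

at-replicate : ∀ k x {p} → p < k → at (replicate k x) p ≡ x
at-replicate (suc k) x {zero}  _   = refl
at-replicate (suc k) x {suc p} p<k = at-replicate k x (s<s⁻¹ p<k)

at-blocks : ∀ x y a b {p} → p < a + b → at (replicate a x ++ replicate b y) p ≡ (if does (p <? a) then x else y)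
at-blocks x y a b {p} p<a+b with p <? a
... | yes p<a rewrite dec-true (p <? a) p<a =
  trans (at-++ˡ (replicate a x) _ (subst (p <_) (sym (length-replicate a)) p<a)) (at-replicate a x p<a)
... | no  p≮a rewrite dec-false (p <? a) p≮a = begin
  at (replicate a x ++ replicate b y) p                ≡⟨ cong (at (replicate a x ++ replicate b y)) (m+[n∸m]≡n a≤p) ⟨
  at (replicate a x ++ replicate b y) (a + (p ∸ a))
    ≡⟨ cong (λ n → at (replicate a x ++ replicate b y) (n + (p ∸ a))) (length-replicate a) ⟨
  at (replicate a x ++ replicate b y) (length (replicate a x) + (p ∸ a)) ≡⟨ at-++ʳ (replicate a x) _ (p ∸ a) ⟩
  at (replicate b y) (p ∸ a)                          ≡⟨ at-replicate b y (subst (p ∸ a <_) (m+n∸m≡n a b) (∸-monoˡ-< p<a+b a≤p)) ⟩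
  y                                                   ∎
  where
  open ≡-Reasoning
  a≤p = ≮⇒≥ p≮a

sum-replicate : ∀ n x → sum (replicate n x) ≡ n * x
sum-replicate zero    x = refl
sum-replicate (suc n) x = cong (x +_) (sum-replicate n x)

∑<-at : ∀ xs → ∑< (length xs) (at xs) ≡ sum xs
∑<-at []       = refl
∑<-at (x ∷ xs) = cong (x +_) (∑<-at xs)

erdős-gallai : ∀ s (G : Graph (length s)) → Realizes s G → ∀ p → p ≤ length s →
  ∑< p (at s) ≤ p * (p ∸ 1) + ∑[ y < length s ∸ p ] at s (p + y)
erdős-gallai s G (π , degree-π) p p≤n =
  subst₂ (λ x y → x ≤ p * (p ∸ 1) + y)
    (∑<-cong p (λ a a<p → row (<-≤-trans a<p p≤n)))
    (∑<-cong (n ∸ p) (λ y y<n∸p → row (subst (p + y <_) (m+[n∸m]≡n p≤n) (+-monoʳ-< p y<n∸p))))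
    (double-counting n p matrix p≤n matrix≤1 matrix-sym matrix-diag)
  where
  open Relabelling G π
  n = length s
  row : ∀ {a} → a < n → ∑< n (matrix a) ≡ at s a
  row {a} a<n = trans (matrix-row a<n)
    (trans (degree-π (fromℕ< a<n)) (trans (lookup≡at s _) (cong (at s) (Fin.toℕ-fromℕ< a<n))))

erdős-gallai-split : ∀ hs ls → IsDegreeSequence (hs ++ ls) → sum hs ≤ length hs * (length hs ∸ 1) + sum ls
erdős-gallai-split hs ls (G , realization) = subst₂ (λ x y → x ≤ length hs * (length hs ∸ 1) + y) head tail
  (erdős-gallai (hs ++ ls) G realization (length hs) (subst (length hs ≤_) (sym (length-++ hs)) (m≤m+n _ _)))
  where
  head : ∑< (length hs) (at (hs ++ ls)) ≡ sum hs
  head = trans (∑<-cong (length hs) (λ y y< → at-++ˡ hs ls y<)) (∑<-at hs)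
  tail : ∑[ y < length (hs ++ ls) ∸ length hs ] at (hs ++ ls) (length hs + y) ≡ sum ls
  tail = trans (cong (λ n → ∑[ y < n ] at (hs ++ ls) (length hs + y))
                      (trans (cong (_∸ length hs) (length-++ hs)) (m+n∸m≡n (length hs) (length ls))))
               (trans (∑<-cong (length ls) (λ y _ → at-++ʳ hs ls y)) (∑<-at ls))

module RelationGraph (n : ℕ) (R : ℕ → ℕ → Bool)
  (R-sym : ∀ {x y} → x < n → y < n → R x y ≡ R y x) (R-irrefl : ∀ {x} → x < n → R x x ≡ false) where

  graph : Graph n
  graph = record
    { adj    = λ i j → R (toℕ i) (toℕ j)
    ; sym    = λ i j → R-sym (Fin.toℕ<n i) (Fin.toℕ<n j)
    ; irrefl = λ i → R-irrefl (Fin.toℕ<n i)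
    }

  degree-graph : ∀ i → degree graph i ≡ ∑[ y < n ] ind (R (toℕ i) y)
  degree-graph i = trans (degree-∑ graph i) (Fin∑-toℕ n (λ y → ind (R (toℕ i) y)))

relation-realizes : ∀ s {R : ℕ → ℕ → Bool}
  (R-sym : ∀ {x y} → x < length s → y < length s → R x y ≡ R y x) (R-irrefl : ∀ {x} → x < length s → R x x ≡ false) →
  (∀ x → x < length s → ∑[ y < length s ] ind (R x y) ≡ at s x) →
  Realizes s (RelationGraph.graph (length s) R R-sym R-irrefl)
relation-realizes s R-sym R-irrefl degrees = Perm.id , λ i →
  trans (degree-graph i) (trans (degrees (toℕ i) (Fin.toℕ<n i)) (sym (lookup≡at s i)))
  where open RelationGraph (length s) _ R-sym R-irrefl

-- Position p < nH is the H-vertex p and position nH + q the L-vertex q; HH, HL and LL give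
-- adjacency inside H, between H and L (H-index first) and inside L.
module TwoSided (nH nL : ℕ) (HH HL LL : ℕ → ℕ → Bool) where

  adjacency : ℕ → ℕ → Bool
  adjacency x y =
    if does (x <? nH)
      then (if does (y <? nH) then HH x y else HL x (y ∸ nH))
      else (if does (y <? nH) then HL y (x ∸ nH) else LL (x ∸ nH) (y ∸ nH))

  data Side (x : ℕ) : Set where
    inH : x < nH → Side x
    inL : ∀ {q} → q < nL → x ≡ nH + q → Side x

  side : ∀ {x} → x < nH + nL → Side x
  side {x} x<n with x <? nH
  ... | yes x<nH = inH x<nH
  ... | no  x≮nH = inL (subst (x ∸ nH <_) (m+n∸m≡n nH nL) (∸-monoˡ-< x<n nH≤x)) (sym (m+[n∸m]≡n nH≤x))
    where nH≤x = ≮⇒≥ x≮nH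

  adjacency-HH : ∀ {p p′} → p < nH → p′ < nH → adjacency p p′ ≡ HH p p′
  adjacency-HH {p} {p′} p<nH p′<nH rewrite dec-true (p <? nH) p<nH | dec-true (p′ <? nH) p′<nH = refl

  adjacency-HL : ∀ {p} q → p < nH → adjacency p (nH + q) ≡ HL p q
  adjacency-HL {p} q p<nH
    rewrite dec-true (p <? nH) p<nH | dec-false (nH + q <? nH) (m+n≮m nH q) | m+n∸m≡n nH q = refl

  adjacency-LH : ∀ {p} q → p < nH → adjacency (nH + q) p ≡ HL p q
  adjacency-LH {p} q p<nH
    rewrite dec-true (p <? nH) p<nH | dec-false (nH + q <? nH) (m+n≮m nH q) | m+n∸m≡n nH q = refl

  adjacency-LL : ∀ q q′ → adjacency (nH + q) (nH + q′) ≡ LL q q′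
  adjacency-LL q q′
    rewrite dec-false (nH + q <? nH) (m+n≮m nH q) | dec-false (nH + q′ <? nH) (m+n≮m nH q′)
          | m+n∸m≡n nH q | m+n∸m≡n nH q′ = refl

  adjacency-irrefl : (∀ {p} → p < nH → HH p p ≡ false) → (∀ {q} → q < nL → LL q q ≡ false) →
                     ∀ {x} → x < nH + nL → adjacency x x ≡ false
  adjacency-irrefl HH-irrefl LL-irrefl x<n with side x<n
  ... | inH x<nH          = trans (adjacency-HH x<nH x<nH) (HH-irrefl x<nH)
  ... | inL {q} q<nL refl = trans (adjacency-LL q q) (LL-irrefl q<nL)

  adjacency-sym : (∀ {p p′} → p < nH → p′ < nH → HH p p′ ≡ HH p′ p) →
                  (∀ {q q′} → q < nL → q′ < nL → LL q q′ ≡ LL q′ q) →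
                  ∀ {x y} → x < nH + nL → y < nH + nL → adjacency x y ≡ adjacency y x
  adjacency-sym HH-sym LL-sym x<n y<n with side x<n | side y<n
  ... | inH p<           | inH p′<            = trans (adjacency-HH p< p′<) (trans (HH-sym p< p′<) (sym (adjacency-HH p′< p<)))
  ... | inH p<           | inL {q} _ refl     = trans (adjacency-HL q p<) (sym (adjacency-LH q p<))
  ... | inL {q} _ refl   | inH p<             = trans (adjacency-LH q p<) (sym (adjacency-HL q p<))
  ... | inL {q} q< refl  | inL {q′} q′< refl  = trans (adjacency-LL q q′) (trans (LL-sym q< q′<) (sym (adjacency-LL q′ q)))

  InIndependentTripleAt : ℕ → Set
  InIndependentTripleAt x = ∃ λ y → ∃ λ y′ → y < nH + nL × y′ < nH + nL × x ≢ y × x ≢ y′ × y ≢ y′ ×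
    adjacency x y ≡ false × adjacency x y′ ≡ false × adjacency y y′ ≡ false

  degreeH : ℕ → ℕ
  degreeH p = ∑[ p′ < nH ] ind (HH p p′) + ∑[ q < nL ] ind (HL p q)

  degreeL : ℕ → ℕ
  degreeL q = ∑[ p < nH ] ind (HL p q) + ∑[ q′ < nL ] ind (LL q q′)

  ∑-adjacency-H : ∀ {p} → p < nH → ∑[ y < nH + nL ] ind (adjacency p y) ≡ degreeH p
  ∑-adjacency-H {p} p<nH = trans (∑<-+ nH nL _)
    (cong₂ _+_ (∑<-cong nH (λ p′ p′<nH → cong ind (adjacency-HH p<nH p′<nH)))
               (∑<-cong nL (λ q _ → cong ind (adjacency-HL q p<nH))))

  ∑-adjacency-L : ∀ q → ∑[ y < nH + nL ] ind (adjacency (nH + q) y) ≡ degreeL q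
  ∑-adjacency-L q = trans (∑<-+ nH nL _)
    (cong₂ _+_ (∑<-cong nH (λ p p<nH → cong ind (adjacency-LH q p<nH)))
               (∑<-cong nL (λ q′ _ → cong ind (adjacency-LL q q′))))

  module Graphs (HH-sym : ∀ {p p′} → p < nH → p′ < nH → HH p p′ ≡ HH p′ p)
                (LL-sym : ∀ {q q′} → q < nL → q′ < nL → LL q q′ ≡ LL q′ q)
                (HH-irrefl : ∀ {p} → p < nH → HH p p ≡ false) (LL-irrefl : ∀ {q} → q < nL → LL q q ≡ false) where

    module On (n : ℕ) (n≡ : n ≡ nH + nL) where

      bounded : ∀ {x} → x < n → x < nH + nL
      bounded {x} = subst (x <_) n≡

      symmetric : ∀ {x y} → x < n → y < n → adjacency x y ≡ adjacency y x
      symmetric x<n y<n = adjacency-sym HH-sym LL-sym (bounded x<n) (bounded y<n)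

      irreflexive : ∀ {x} → x < n → adjacency x x ≡ false
      irreflexive x<n = adjacency-irrefl HH-irrefl LL-irrefl (bounded x<n)

      graph : Graph n
      graph = RelationGraph.graph n adjacency symmetric irreflexive

      vertex : ∀ {x} → x < nH + nL → Fin n
      vertex {x} x<n = fromℕ< (subst (x <_) (sym n≡) x<n)

      vertex-toℕ : ∀ {x} (x<n : x < nH + nL) → toℕ (vertex x<n) ≡ x
      vertex-toℕ x<n = Fin.toℕ-fromℕ< _

      H< : ∀ {p} → p < nH → p < nH + nL
      H< p<nH = ≤-trans p<nH (m≤m+n nH nL)

      L< : ∀ {q} → q < nL → nH + q < nH + nL
      L< = +-monoʳ-< nH

      side-of : (i : Fin n) → Side (toℕ i)
      side-of i = side (bounded (Fin.toℕ<n i))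

      degree-graph : ∀ i → degree graph i ≡ ∑[ y < nH + nL ] ind (adjacency (toℕ i) y)
      degree-graph i = trans (RelationGraph.degree-graph n adjacency symmetric irreflexive i)
                             (cong (λ m → ∑[ y < m ] ind (adjacency (toℕ i) y)) n≡)

      degree-H : ∀ i → toℕ i < nH → degree graph i ≡ degreeH (toℕ i)
      degree-H i i<nH = trans (degree-graph i) (∑-adjacency-H i<nH)

      degree-L : ∀ i {q} → toℕ i ≡ nH + q → degree graph i ≡ degreeL q
      degree-L i {q} i≡ = trans (degree-graph i) (trans (cong (λ x → ∑[ y < nH + nL ] ind (adjacency x y)) i≡) (∑-adjacency-L q))

      independent-triple : ∀ u → InIndependentTripleAt (toℕ u) → InIndependentTriple graph u
      independent-triple u (x , y , x<n , y<n , u≢x , u≢y , x≢y , ux , uy , xy) =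
        vertex x<n , vertex y<n ,
        (λ u≡ → u≢x (trans (cong toℕ u≡) (vertex-toℕ x<n))) ,
        (λ u≡ → u≢y (trans (cong toℕ u≡) (vertex-toℕ y<n))) ,
        (λ x≡ → x≢y (trans (sym (vertex-toℕ x<n)) (trans (cong toℕ x≡) (vertex-toℕ y<n)))) ,
        trans (cong (adjacency (toℕ u)) (vertex-toℕ x<n)) ux ,
        trans (cong (adjacency (toℕ u)) (vertex-toℕ y<n)) uy ,
        trans (cong₂ adjacency (vertex-toℕ x<n) (vertex-toℕ y<n)) xy

      independent-neighbourhood : ∀ {x} (x<n : x < nH + nL) →
        (∀ {y y′} → y < nH + nL → y′ < nH + nL → adjacency x y ≡ true → adjacency x y′ ≡ true → adjacency y y′ ≡ false) →
        IndependentNeighbourhood graph (vertex x<n)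
      independent-neighbourhood x<n independent a b xa xb =
        independent (bounded (Fin.toℕ<n a)) (bounded (Fin.toℕ<n b))
          (trans (cong (λ z → adjacency z (toℕ a)) (sym (vertex-toℕ x<n))) xa)
          (trans (cong (λ z → adjacency z (toℕ b)) (sym (vertex-toℕ x<n))) xb)

      H-clique⇒¬selfComplementary : ∀ t → (∀ {p p′} → p < nH → p′ < nH → p ≢ p′ → HH p p′ ≡ true) →
        (∀ {q} → q < nL → degreeL q < t) →
        ∀ {q q′} → q < nL → q′ < nL → LL q q′ ≡ true → degreeL q + t < n → degreeL q′ + t < n →
        ¬ SelfComplementary graph
      H-clique⇒¬selfComplementary t H-clique L-low {q} {q′} q<nL q′<nL qq′ q-low q′-low =
        highClique⇒¬selfComplementary graph t clique {vertex (L< q<nL)} {vertex (L< q′<nL)}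
          (trans (cong₂ adjacency (vertex-toℕ (L< q<nL)) (vertex-toℕ (L< q′<nL))) (trans (adjacency-LL q q′) qq′))
          (subst (λ x → x + t < n) (sym (degree-L _ (vertex-toℕ (L< q<nL)))) q-low)
          (subst (λ x → x + t < n) (sym (degree-L _ (vertex-toℕ (L< q′<nL)))) q′-low)
        where
        clique : ∀ u v → u ≢ v → t ≤ degree graph u → t ≤ degree graph v → adj graph u v ≡ true
        clique u v u≢v tu tv with side-of u | side-of v
        ... | inL r<nL u≡ | _          = ⊥-elim (<⇒≱ (L-low r<nL) (subst (t ≤_) (degree-L u u≡) tu))
        ... | inH _       | inL r<nL v≡ = ⊥-elim (<⇒≱ (L-low r<nL) (subst (t ≤_) (degree-L v v≡) tv))
        ... | inH u<nH    | inH v<nH   = trans (adjacency-HH u<nH v<nH) (H-clique u<nH v<nH (u≢v ∘ Fin.toℕ-injective))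

      H-vertex : ∀ {p} → p < nH → Fin n
      H-vertex p<nH = vertex (H< p<nH)

      H-vertex-≢ : ∀ {w p} (p<nH : p < nH) → w ≢ H-vertex p<nH → toℕ w ≢ p
      H-vertex-≢ p<nH w≢ w≡p = w≢ (Fin.toℕ-injective (trans w≡p (sym (vertex-toℕ (H< p<nH)))))

      H-twins : ∀ {p₁ p₂} (p₁<nH : p₁ < nH) (p₂<nH : p₂ < nH) →
        (∀ {p} → p < nH → p ≢ p₁ → p ≢ p₂ → HH p₁ p ≡ HH p₂ p) → (∀ q → HL p₁ q ≡ HL p₂ q) →
        Twins graph (H-vertex p₁<nH) (H-vertex p₂<nH)
      H-twins {p₁} {p₂} p₁<nH p₂<nH HH-twins HL-twins w w≢u w≢v
        rewrite vertex-toℕ (H< p₁<nH) | vertex-toℕ (H< p₂<nH) with side-of w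
      ... | inH w<nH = begin
        adjacency p₁ (toℕ w)  ≡⟨ adjacency-HH p₁<nH w<nH ⟩
        HH p₁ (toℕ w)         ≡⟨ HH-twins w<nH (H-vertex-≢ p₁<nH w≢u) (H-vertex-≢ p₂<nH w≢v) ⟩
        HH p₂ (toℕ w)         ≡⟨ adjacency-HH p₂<nH w<nH ⟨
        adjacency p₂ (toℕ w)  ∎
        where open ≡-Reasoning
      ... | inL {q} _ w≡ = begin
        adjacency p₁ (toℕ w)    ≡⟨ cong (adjacency p₁) w≡ ⟩
        adjacency p₁ (nH + q)   ≡⟨ adjacency-HL q p₁<nH ⟩
        HL p₁ q                 ≡⟨ HL-twins q ⟩
        HL p₂ q                 ≡⟨ adjacency-HL q p₂<nH ⟨
        adjacency p₂ (nH + q)   ≡⟨ cong (adjacency p₂) w≡ ⟨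
        adjacency p₂ (toℕ w)    ∎
        where open ≡-Reasoning

      L-not-twins : ∀ {x y q q′ p} → toℕ x ≡ nH + q → toℕ y ≡ nH + q′ → p < nH → HL p q ≢ HL p q′ → ¬ Twins graph x y
      L-not-twins {x} {y} {q} {q′} {p} x≡ y≡ p<nH distinct xy-twins = distinct (begin
        HL p q                       ≡⟨ adjacency-LH q p<nH ⟨
        adjacency (nH + q) p         ≡⟨ cong₂ adjacency x≡ (vertex-toℕ (H< p<nH)) ⟨
        adjacency (toℕ x) (toℕ w)    ≡⟨ xy-twins w (not-L x≡) (not-L y≡) ⟩
        adjacency (toℕ y) (toℕ w)    ≡⟨ cong₂ adjacency y≡ (vertex-toℕ (H< p<nH)) ⟩
        adjacency (nH + q′) p        ≡⟨ adjacency-LH q′ p<nH ⟩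
        HL p q′                      ∎)
        where
        open ≡-Reasoning
        w = H-vertex p<nH
        not-L : ∀ {z r} → toℕ z ≡ nH + r → w ≢ z
        not-L {r = r} z≡ w≡z = <⇒≱ p<nH (subst (nH ≤_) (trans (sym z≡) (trans (cong toℕ (sym w≡z)) (vertex-toℕ (H< p<nH))))
                                                       (m≤m+n nH r))

      H-twins⇒¬selfComplementary : ∀ dH dL → dH + dL + 1 ≡ n → dL ≢ dH →
        (∀ {p} → p < nH → degreeH p ≡ dH) → (∀ {q} → q < nL → degreeL q ≡ dL) →
        ∀ {p₁ p₂} → p₁ < nH → p₂ < nH → p₁ ≢ p₂ →
        (∀ {p} → p < nH → p ≢ p₁ → p ≢ p₂ → HH p₁ p ≡ HH p₂ p) → (∀ q → HL p₁ q ≡ HL p₂ q) →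
        (∀ {q q′} → q < nL → q′ < nL → q ≢ q′ → ∃ λ p → p < nH × HL p q ≢ HL p q′) →
        ¬ SelfComplementary graph
      H-twins⇒¬selfComplementary dH dL size dL≢dH degH degL p₁<nH p₂<nH p₁≢p₂ HH-twins HL-twins L-distinct =
        twins⇒¬selfComplementary graph dH dL size
          (λ u≡v → p₁≢p₂ (trans (sym (vertex-toℕ (H< p₁<nH))) (trans (cong toℕ u≡v) (vertex-toℕ (H< p₂<nH)))))
          (H-degree (vertex-toℕ (H< p₁<nH)) p₁<nH) (H-degree (vertex-toℕ (H< p₂<nH)) p₂<nH)
          (H-twins p₁<nH p₂<nH HH-twins HL-twins) no-twins
        where
        H-degree : ∀ {w p} → toℕ w ≡ p → p < nH → degree graph w ≡ dH
        H-degree {w} refl p<nH = trans (degree-H w p<nH) (degH p<nH)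
        no-twins : ∀ x y → x ≢ y → degree graph x ≡ dL → degree graph y ≡ dL → ¬ Twins graph x y
        no-twins x y x≢y dx dy with side-of x | side-of y
        ... | inH x<nH | _        = λ _ → dL≢dH (trans (sym dx) (H-degree refl x<nH))
        ... | inL _ _  | inH y<nH = λ _ → dL≢dH (trans (sym dy) (H-degree refl y<nH))
        ... | inL q<nL x≡ | inL q′<nL y≡
          with L-distinct q<nL q′<nL (λ q≡q′ → x≢y (Fin.toℕ-injective (trans x≡ (trans (cong (nH +_) q≡q′) (sym y≡)))))
        ...   | p , p<nH , distinct = L-not-twins x≡ y≡ p<nH distinct

    realizes : ∀ sH sL (sH≡ : length sH ≡ nH) (sL≡ : length sL ≡ nL) →
      (∀ {p} → p < nH → degreeH p ≡ at sH p) → (∀ {q} → q < nL → degreeL q ≡ at sL q) →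
      Realizes (sH ++ sL) (On.graph (length (sH ++ sL)) (trans (length-++ sH) (cong₂ _+_ sH≡ sL≡)))
    realizes sH sL sH≡ sL≡ degH degL = relation-realizes (sH ++ sL) (On.symmetric _ n≡) (On.irreflexive _ n≡) λ x x<n →
      trans (cong (λ m → ∑[ y < m ] ind (adjacency x y)) n≡) (at-side (side (subst (x <_) n≡ x<n)))
      where
      n≡ = trans (length-++ sH) (cong₂ _+_ sH≡ sL≡)
      at-side : ∀ {x} → Side x → ∑[ y < nH + nL ] ind (adjacency x y) ≡ at (sH ++ sL) x
      at-side {p} (inH p<nH) = trans (∑-adjacency-H p<nH)
        (trans (degH p<nH) (sym (at-++ˡ sH sL (subst (p <_) (sym sH≡) p<nH))))
      at-side (inL {q} q<nL refl) = trans (∑-adjacency-L q)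
        (trans (degL q<nL) (trans (sym (at-++ʳ sH sL q)) (cong (λ m → at (sH ++ sL) (m + q)) sH≡)))

    ¬forcibly : ∀ sH sL (sH≡ : length sH ≡ nH) (sL≡ : length sL ≡ nL) →
      (∀ {p} → p < nH → degreeH p ≡ at sH p) → (∀ {q} → q < nL → degreeL q ≡ at sL q) →
      (∀ {n} (n≡ : n ≡ nH + nL) → ¬ SelfComplementary (On.graph n n≡)) →
      ¬ ForciblySelfComplementary (sH ++ sL)
    ¬forcibly sH sL sH≡ sL≡ degH degL ¬sc forcibly = ¬sc n≡ (forcibly (On.graph _ n≡) (realizes sH sL sH≡ sL≡ degH degL))
      where n≡ = trans (length-++ sH) (cong₂ _+_ sH≡ sL≡)

-- The realizations

two-others : ∀ i → ∃ λ x → ∃ λ y → x < 4 × y < 4 × i ≢ x × i ≢ y × x ≢ y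
two-others i with i <? 2
... | yes i<2 = 2 , 3 , s≤s (s≤s (s≤s z≤n)) , ≤-refl , <⇒≢ i<2 , <⇒≢ (m<n⇒m<1+n i<2) , λ ()
... | no  i≮2 = 0 , 1 , z<s , s≤s z<s , (λ i≡0 → i≮2 (subst (_< 2) (sym i≡0) z<s)) ,
                (λ i≡1 → i≮2 (subst (_< 2) (sym i≡1) (s≤s z<s))) , λ ()

-- Sides H = {x₀ … x₂ₖ₋₁} and L = {y₀ … y₂ₖ₋₁, apex}, the apex being L-index 2k:
-- K_{2k,2k} minus the matching xᵢyᵢ (i < k), with the apex joined to the 2k matched vertices.
module RegularGraph (k : ℕ) where

  HH HL LL : ℕ → ℕ → Bool
  HH _ _  = false
  HL i j  = if does (j <? k + k) then not (does (j ≟ i) ∧ does (i <? k)) else does (i <? k)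
  LL j j′ = (does (j ≟ k + k) ∧ does (j′ <? k)) ∨ (does (j′ ≟ k + k) ∧ does (j <? k))

  open TwoSided (k + k) (k + k + 1) HH HL LL public

  LL-Y : ∀ {j j′} → j < k + k → j′ < k + k → LL j j′ ≡ false
  LL-Y {j} {j′} j<2k j′<2k rewrite dec-false (j ≟ k + k) (<⇒≢ j<2k) | dec-false (j′ ≟ k + k) (<⇒≢ j′<2k) = refl

  HL-apex : ∀ i → HL i (k + k) ≡ does (i <? k)
  HL-apex i rewrite dec-false (k + k <? k + k) (n≮n (k + k)) = refl

  LL-apex : ∀ j′ → LL (k + k) j′ ≡ does (j′ <? k)
  LL-apex j′ rewrite dec-true (k + k ≟ k + k) refl | dec-false (k + k <? k) (≤⇒≯ (m≤m+n k k)) =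
    trans (cong (does (j′ <? k) ∨_) (∧-zeroʳ (does (j′ ≟ k + k)))) (∨-identityʳ (does (j′ <? k)))

  apex : ∀ {j} → j < k + k + 1 → ¬ j < k + k → j ≡ k + k
  apex {j} j<n j≮2k = ≤-antisym (≤-pred (subst (j <_) (+-comm (k + k) 1) j<n)) (≮⇒≥ j≮2k)

  degreeH-value : ∀ {i} → i < k + k → degreeH i ≡ k + k
  degreeH-value {i} i<2k = begin
    ∑[ i′ < k + k ] 0 + ∑[ j < k + k + 1 ] ind (HL i j)
      ≡⟨ cong (_+ ∑[ j < k + k + 1 ] ind (HL i j)) (∑<-zero (k + k) (λ _ _ → refl)) ⟩
    ∑[ j < k + k + 1 ] ind (HL i j)                            ≡⟨ ∑<-if (k + k) 1 (λ j → not (P j)) (λ _ → does (i <? k)) ⟩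
    ∑[ j < k + k ] ind (not (P j)) + (ind (does (i <? k)) + 0)
      ≡⟨ cong (∑[ j < k + k ] ind (not (P j)) +_) (trans (+-identityʳ _) (sym (∑<-point _ i<2k))) ⟩
    ∑[ j < k + k ] ind (not (P j)) + ∑[ j < k + k ] ind (P j)    ≡⟨ ∑<-not (k + k) P ⟩
    k + k                                                       ∎
    where
    open ≡-Reasoning
    P : ℕ → Bool
    P j = does (j ≟ i) ∧ does (i <? k)

  degreeL-Y : ∀ {j} → j < k + k → degreeL j ≡ k + k
  degreeL-Y {j} j<2k = begin
    ∑[ i < k + k ] ind (HL i j) + ∑[ j′ < k + k + 1 ] ind (LL j j′)
      ≡⟨ cong₂ _+_ (∑<-cong (k + k) (λ i _ → cong (λ b → ind (if b then not (P i) else does (i <? k))) (dec-true (j <? k + k) j<2k)))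
                   (∑<-cong (k + k + 1) (λ j′ _ → cong (λ b → ind ((b ∧ does (j′ <? k)) ∨ (does (j′ ≟ k + k) ∧ does (j <? k))))
                                                      (dec-false (j ≟ k + k) (<⇒≢ j<2k)))) ⟩
    ∑[ i < k + k ] ind (not (P i)) + ∑[ j′ < k + k + 1 ] ind (does (j′ ≟ k + k) ∧ does (j <? k))
      ≡⟨ cong (∑[ i < k + k ] ind (not (P i)) +_) (trans (∑<-point _ (m<m+n (k + k) z<s)) (sym (∑<-point _ j<2k))) ⟩
    ∑[ i < k + k ] ind (not (P i)) + ∑[ i < k + k ] ind (does (i ≟ j) ∧ does (i <? k))
      ≡⟨ cong (∑[ i < k + k ] ind (not (P i)) +_) (∑<-cong (k + k) (λ i _ → cong (λ b → ind (b ∧ does (i <? k))) (≟-sym i j))) ⟩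
    ∑[ i < k + k ] ind (not (P i)) + ∑[ i < k + k ] ind (P i)
      ≡⟨ ∑<-not (k + k) P ⟩
    k + k ∎
    where
    open ≡-Reasoning
    P : ℕ → Bool
    P i = does (j ≟ i) ∧ does (i <? k)

  degreeL-apex : degreeL (k + k) ≡ k + k
  degreeL-apex = begin
    ∑[ i < k + k ] ind (HL i (k + k)) + ∑[ j′ < k + k + 1 ] ind (LL (k + k) j′)
      ≡⟨ cong₂ _+_ (∑<-cong (k + k) (λ i _ → cong ind (HL-apex i))) (∑<-cong (k + k + 1) (λ j′ _ → cong ind (LL-apex j′))) ⟩
    ∑[ i < k + k ] ind (does (i <? k)) + ∑[ j′ < k + k + 1 ] ind (does (j′ <? k))
      ≡⟨ cong₂ _+_ (∑<-lt (m≤m+n k k)) (∑<-lt (≤-trans (m≤m+n k k) (m≤m+n (k + k) 1))) ⟩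
    k + k ∎
    where open ≡-Reasoning

  degreeL-value : ∀ {j} → j < k + k + 1 → degreeL j ≡ k + k
  degreeL-value {j} j<n with j <? k + k
  ... | yes j<2k = degreeL-Y j<2k
  ... | no  j≮2k rewrite apex j<n j≮2k = degreeL-apex

  HH-sym : ∀ {i i′} → i < k + k → i′ < k + k → HH i i′ ≡ HH i′ i
  HH-sym _ _ = refl

  LL-sym : ∀ {j j′} → j < k + k + 1 → j′ < k + k + 1 → LL j j′ ≡ LL j′ j
  LL-sym {j} {j′} _ _ = ∨-comm (does (j ≟ k + k) ∧ does (j′ <? k)) _

  HH-irrefl : ∀ {i} → i < k + k → HH i i ≡ false
  HH-irrefl _ = refl

  LL-irrefl : ∀ {j} → j < k + k + 1 → LL j j ≡ false
  LL-irrefl {j} j<n with j <? k + k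
  ... | yes j<2k = LL-Y j<2k j<2k
  ... | no  j≮2k rewrite apex j<n j≮2k = trans (LL-apex (k + k)) (dec-false (k + k <? k) (≤⇒≯ (m≤m+n k k)))

  open Graphs HH-sym LL-sym HH-irrefl LL-irrefl public

  module _ (2≤k : 2 ≤ k) where

    k<2k : k < k + k
    k<2k = m<m+n k (≤-trans z<s 2≤k)

    k+1<2k : suc k < k + k
    k+1<2k = subst (_< k + k) (+-comm k 1) (+-monoʳ-< k 2≤k)

    <4⇒<2k : ∀ {x} → x < 4 → x < k + k
    <4⇒<2k x<4 = ≤-trans x<4 (+-mono-≤ 2≤k 2≤k)

    H<N : ∀ {i} → i < k + k → i < (k + k) + (k + k + 1)
    H<N i<2k = ≤-trans i<2k (m≤m+n (k + k) (k + k + 1))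

    apex-not-X : ∀ {i} → i < k + k → k ≤ i → adjacency (k + k + (k + k)) i ≡ false
    apex-not-X {i} i<2k k≤i = trans (adjacency-LH (k + k) i<2k) (trans (HL-apex i) (dec-false (i <? k) (≤⇒≯ k≤i)))

    neighbour-of-xₖ : ∀ {x} → x < (k + k) + (k + k + 1) → adjacency k x ≡ true → ∃ λ j → j < k + k × x ≡ k + k + j
    neighbour-of-xₖ x<N kx with side x<N
    ... | inH x<2k = ⊥-elim (true≢false (trans (sym kx) (adjacency-HH k<2k x<2k)))
    ... | inL {j} j<n refl with j <? k + k
    ...   | yes j<2k = j , j<2k , refl
    ...   | no  j≮2k = ⊥-elim (true≢false (trans (sym kx) (trans (adjacency-sym HH-sym LL-sym (H<N k<2k) x<N)
                         (trans (cong (λ j → adjacency (k + k + j) k) (apex j<n j≮2k)) (apex-not-X k<2k ≤-refl)))))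

    independent-neighbourhood-of-xₖ : ∀ {y y′} → y < (k + k) + (k + k + 1) → y′ < (k + k) + (k + k + 1) →
      adjacency k y ≡ true → adjacency k y′ ≡ true → adjacency y y′ ≡ false
    independent-neighbourhood-of-xₖ y<N y′<N ky ky′ with neighbour-of-xₖ y<N ky | neighbour-of-xₖ y′<N ky′
    ... | j , j<2k , refl | j′ , j′<2k , refl = trans (adjacency-LL j j′) (LL-Y j<2k j′<2k)

    in-independent-triple : ∀ {x} → x < (k + k) + (k + k + 1) → InIndependentTripleAt x
    in-independent-triple x<N with side x<N
    ... | inH x<2k with two-others _
    ...   | y , y′ , y<4 , y′<4 , x≢y , x≢y′ , y≢y′ =
      y , y′ , H<N (<4⇒<2k y<4) , H<N (<4⇒<2k y′<4) , x≢y , x≢y′ , y≢y′ ,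
      adjacency-HH x<2k (<4⇒<2k y<4) , adjacency-HH x<2k (<4⇒<2k y′<4) , adjacency-HH (<4⇒<2k y<4) (<4⇒<2k y′<4)
    in-independent-triple x<N | inL {j} j<n refl with j <? k + k
    ... | yes j<2k with two-others j
    ...   | y , y′ , y<4 , y′<4 , j≢y , j≢y′ , y≢y′ =
      k + k + y , k + k + y′ , +-monoʳ-< (k + k) (L y<4) , +-monoʳ-< (k + k) (L y′<4) ,
      j≢y ∘ +-cancelˡ-≡ (k + k) j y , j≢y′ ∘ +-cancelˡ-≡ (k + k) j y′ , y≢y′ ∘ +-cancelˡ-≡ (k + k) y y′ ,
      trans (adjacency-LL j y) (LL-Y j<2k (<4⇒<2k y<4)) , trans (adjacency-LL j y′) (LL-Y j<2k (<4⇒<2k y′<4)) ,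
      trans (adjacency-LL y y′) (LL-Y (<4⇒<2k y<4) (<4⇒<2k y′<4))
      where
      L : ∀ {y} → y < 4 → y < k + k + 1
      L y<4 = <-≤-trans (<4⇒<2k y<4) (m≤m+n (k + k) 1)
    in-independent-triple x<N | inL {j} j<n refl | no j≮2k rewrite apex j<n j≮2k =
      k , suc k , H<N k<2k , H<N k+1<2k , apex≢ k<2k , apex≢ k+1<2k , <⇒≢ (n<1+n k) ,
      apex-not-X k<2k ≤-refl , apex-not-X k+1<2k (n≤1+n k) , adjacency-HH k<2k k+1<2k
      where
      apex≢ : ∀ {i} → i < k + k → k + k + (k + k) ≢ i
      apex≢ i<2k eq = <⇒≢ (<-≤-trans i<2k (m≤m+n (k + k) (k + k))) (sym eq)

    ¬selfComplementary : ∀ {n} (n≡ : n ≡ (k + k) + (k + k + 1)) → ¬ SelfComplementary (On.graph n n≡)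
    ¬selfComplementary {n} n≡ = independentNeighbourhood⇒¬selfComplementary graph _
      (independent-neighbourhood (H<N k<2k) independent-neighbourhood-of-xₖ)
      (λ u → independent-triple u (in-independent-triple (bounded (Fin.toℕ<n u))))
      where open On n n≡

  ¬forcibly-regular : 2 ≤ k → ¬ ForciblySelfComplementary (replicate (k + k) (k + k) ++ replicate (k + k + 1) (k + k))
  ¬forcibly-regular 2≤k = ¬forcibly (replicate (k + k) (k + k)) (replicate (k + k + 1) (k + k))
    (length-replicate (k + k)) (length-replicate (k + k + 1))
    (λ i<2k → trans (degreeH-value i<2k) (sym (at-replicate (k + k) _ i<2k)))
    (λ j<n → trans (degreeL-value j<n) (sym (at-replicate (k + k + 1) _ j<n)))
    (¬selfComplementary 2≤k)

-- H = H₁ ∪ H₂ with H₁ the first k − 1 indices, L = L₁ ∪ L₂ with L₁ the first k indices;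
-- H is a clique, L is independent, H₁ is complete to L₁, and the r-th vertex of H₂ is
-- adjacent to the r-th vertex of L₁ and to all of L₂ except its r-th vertex.
module TwinGraph (a : ℕ) where

  k : ℕ
  k = suc a

  HH HL LL : ℕ → ℕ → Bool
  HH p p′ = not (does (p ≟ p′))
  HL p q  = if does (p <? a) then does (q <? k)
            else if does (q <? k) then does (q ≟ p ∸ a) else not (does (q ∸ k ≟ p ∸ a))
  LL _ _  = false

  open TwoSided (k + k) (k + k) HH HL LL public

  HL-row : ∀ p → ∑[ q < k + k ] ind (HL p q) ≡ k
  HL-row p with p <? a
  ... | yes p<a rewrite dec-true (p <? a) p<a = ∑<-lt (m≤m+n k k)
  ... | no  p≮a rewrite dec-false (p <? a) p≮a =
    trans (∑<-if k k (λ q → does (q ≟ p ∸ a)) (λ j → not (does (j ≟ p ∸ a))))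
          (trans (+-comm (∑[ q < k ] ind (does (q ≟ p ∸ a))) _) (∑<-not k (λ j → does (j ≟ p ∸ a))))

  HL-column : ∀ {q} → q < k + k → ∑[ p < k + k ] ind (HL p q) ≡ k
  HL-column {q} q<2k = trans (cong (λ m → ∑[ p < m ] ind (HL p q)) (sym (+-suc a k)))
    (trans (∑<-if a (suc k) (λ _ → does (q <? k)) (λ r → if does (q <? k) then does (q ≟ r) else not (does (q ∸ k ≟ r))))
           (split (q <? k)))
    where
    split : Dec (q < k) → ∑[ _ < a ] ind (does (q <? k))
                        + ∑[ r < suc k ] ind (if does (q <? k) then does (q ≟ r) else not (does (q ∸ k ≟ r))) ≡ k
    split (yes q<k) rewrite dec-true (q <? k) q<k =
      trans (cong₂ _+_ (∑<-one a (λ _ _ → refl)) (∑<-≟ (m<n⇒m<1+n q<k))) (+-comm a 1)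
    split (no  q≮k) rewrite dec-false (q <? k) q≮k =
      trans (cong (_+ X) (∑<-zero a (λ _ _ → refl))) (+-cancelʳ-≡ 1 X k (trans (∑<-≢ j<1+k) (+-comm 1 k)))
      where
      X = ∑[ r < suc k ] ind (not (does (q ∸ k ≟ r)))
      j<1+k : q ∸ k < suc k
      j<1+k = m<n⇒m<1+n (subst (q ∸ k <_) (m+n∸m≡n k k) (∸-monoˡ-< q<2k (≮⇒≥ q≮k)))

  degreeH-value : ∀ {p} → p < k + k → degreeH p ≡ a + k + k
  degreeH-value {p} p<2k = cong₂ _+_ (+-cancelʳ-≡ 1 _ (a + k) (trans (∑<-≢ p<2k) (+-comm 1 (a + k)))) (HL-row p)

  degreeL-value : ∀ {q} → q < k + k → degreeL q ≡ k
  degreeL-value q<2k = trans (cong₂ _+_ (HL-column q<2k) (∑<-zero (k + k) (λ _ _ → refl))) (+-identityʳ k)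

  HH-sym : ∀ {p p′} → p < k + k → p′ < k + k → HH p p′ ≡ HH p′ p
  HH-sym {p} {p′} _ _ = cong not (≟-sym p p′)

  LL-sym : ∀ {q q′} → q < k + k → q′ < k + k → LL q q′ ≡ LL q′ q
  LL-sym _ _ = refl

  HH-irrefl : ∀ {p} → p < k + k → HH p p ≡ false
  HH-irrefl {p} _ = cong not (dec-true (p ≟ p) refl)

  LL-irrefl : ∀ {q} → q < k + k → LL q q ≡ false
  LL-irrefl _ = refl

  open Graphs HH-sym LL-sym HH-irrefl LL-irrefl public

  HL-H₁ : ∀ {p} q → p < a → HL p q ≡ does (q <? k)
  HL-H₁ {p} q p<a rewrite dec-true (p <? a) p<a = refl

  HL-H₂ : ∀ r q → HL (a + r) q ≡ (if does (q <? k) then does (q ≟ r) else not (does (q ∸ k ≟ r)))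
  HL-H₂ r q rewrite dec-false (a + r <? a) (m+n≮m a r) | m+n∸m≡n a r = refl

  HL-H₂-L₁ : ∀ r {q} → q < k → HL (a + r) q ≡ does (q ≟ r)
  HL-H₂-L₁ r {q} q<k rewrite HL-H₂ r q | dec-true (q <? k) q<k = refl

  HL-H₂-L₂ : ∀ r {q} → ¬ q < k → HL (a + r) q ≡ not (does (q ∸ k ≟ r))
  HL-H₂-L₂ r {q} q≮k rewrite HL-H₂ r q | dec-false (q <? k) q≮k = refl

  L-distinguished : 0 < a → ∀ {q q′} → q < k + k → q′ < k + k → q ≢ q′ → ∃ λ p → p < k + k × HL p q ≢ HL p q′
  L-distinguished 0<a {q} {q′} q<2k q′<2k q≢q′ with q <? k | q′ <? k
  ... | yes q<k | yes q′<k = a + q , +-mono-< (n<1+n a) q<k , λ eq →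
    true≢false (begin
      true                ≡⟨ dec-true (q ≟ q) refl ⟨
      does (q ≟ q)        ≡⟨ HL-H₂-L₁ q q<k ⟨
      HL (a + q) q        ≡⟨ eq ⟩
      HL (a + q) q′       ≡⟨ HL-H₂-L₁ q q′<k ⟩
      does (q′ ≟ q)       ≡⟨ dec-false (q′ ≟ q) (q≢q′ ∘ sym) ⟩
      false               ∎)
    where open ≡-Reasoning
  ... | no q≮k | no q′≮k = a + (q ∸ k) , +-mono-< (n<1+n a) (below q<2k q≮k) , λ eq →
    true≢false (begin
      true                              ≡⟨ cong not (dec-false (q′ ∸ k ≟ q ∸ k) (q≢q′ ∘ sym ∘ cancel)) ⟨
      not (does (q′ ∸ k ≟ q ∸ k))       ≡⟨ HL-H₂-L₂ (q ∸ k) q′≮k ⟨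
      HL (a + (q ∸ k)) q′               ≡⟨ eq ⟨
      HL (a + (q ∸ k)) q                ≡⟨ HL-H₂-L₂ (q ∸ k) q≮k ⟩
      not (does (q ∸ k ≟ q ∸ k))        ≡⟨ cong not (dec-true (q ∸ k ≟ q ∸ k) refl) ⟩
      false                             ∎)
    where
    open ≡-Reasoning
    below : ∀ {x} → x < k + k → ¬ x < k → x ∸ k < k
    below {x} x<2k x≮k = subst (x ∸ k <_) (m+n∸m≡n k k) (∸-monoˡ-< x<2k (≮⇒≥ x≮k))
    cancel : q′ ∸ k ≡ q ∸ k → q′ ≡ q
    cancel eq = trans (sym (m∸n+n≡m (≮⇒≥ q′≮k))) (trans (cong (_+ k) eq) (m∸n+n≡m (≮⇒≥ q≮k)))
  ... | yes q<k | no q′≮k = 0 , ≤-trans 0<a (≤-trans (n≤1+n a) (m≤m+n k k)) , λ eq →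
    true≢false (trans (sym (trans (HL-H₁ q 0<a) (dec-true (q <? k) q<k)))
                      (trans eq (trans (HL-H₁ q′ 0<a) (dec-false (q′ <? k) q′≮k))))
  ... | no q≮k | yes q′<k = 0 , ≤-trans 0<a (≤-trans (n≤1+n a) (m≤m+n k k)) , λ eq →
    true≢false (trans (sym (trans (HL-H₁ q′ 0<a) (dec-true (q′ <? k) q′<k)))
                      (trans (sym eq) (trans (HL-H₁ q 0<a) (dec-false (q <? k) q≮k))))

  ¬selfComplementary : 2 ≤ a → ∀ {n} (n≡ : n ≡ (k + k) + (k + k)) → ¬ SelfComplementary (On.graph n n≡)
  ¬selfComplementary 2≤a {n} n≡ =
    H-twins⇒¬selfComplementary (a + k + k) k size low≢high degreeH-value degreeL-value {0} {1} (H₁ 0<a) (H₁ 2≤a) (λ ())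
      (λ {p} _ p≢0 p≢1 → cong not (trans (dec-false (0 ≟ p) (p≢0 ∘ sym)) (sym (dec-false (1 ≟ p) (p≢1 ∘ sym)))))
      (λ q → trans (HL-H₁ q 0<a) (sym (HL-H₁ q 2≤a)))
      (L-distinguished 0<a)
    where
    open On n n≡
    0<a = ≤-trans (s≤s z≤n) 2≤a
    H₁ : ∀ {p} → p < a → p < k + k
    H₁ p<a = ≤-trans p<a (≤-trans (n≤1+n a) (m≤m+n k k))
    size : a + k + k + k + 1 ≡ n
    size = trans (solve 2 (λ a k → a :+ k :+ k :+ k :+ con 1 := (k :+ k) :+ (k :+ a :+ con 1)) refl a k)
                 (trans (cong (λ x → (k + k) + x) (trans (+-assoc k a 1) (cong (k +_) (+-comm a 1)))) (sym n≡))
    low≢high : k ≢ a + k + k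
    low≢high = <⇒≢ (<-≤-trans (m<m+n k z<s) (subst (k + k ≤_) (sym (+-assoc a k k)) (m≤n+m (k + k) a)))

  ¬forcibly-twin : 2 ≤ a → ¬ ForciblySelfComplementary (replicate (k + k) (a + k + k) ++ replicate (k + k) k)
  ¬forcibly-twin 2≤a = ¬forcibly (replicate (k + k) (a + k + k)) (replicate (k + k) k)
    (length-replicate (k + k)) (length-replicate (k + k))
    (λ p<2k → trans (degreeH-value p<2k) (sym (at-replicate (k + k) _ p<2k)))
    (λ q<2k → trans (degreeL-value q<2k) (sym (at-replicate (k + k) _ q<2k)))
    (¬selfComplementary 2≤a)

-- Both sides are indexed by ℤ/N with N = 2m, m = s + 1 + z; the classes are A = H-indices
-- below a, B = the other H-indices, C = L-indices below b and D = the other L-indices.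
-- H is a clique; H_p ~ L_q iff p + q + m + 1 is among the first s residues, or is the
-- (s+1)-th one and p ∈ A; L_q ~ L_q′ iff q′ is one of the z successors of q, or its
-- (z+1)-th successor and in C, or vice versa.  The offset m + 1 makes L_q lose its
-- (s+1)-th H-neighbour exactly when its (z+1)-th successor lies in C, which balances the
-- degrees to s + 1 + 2z on D and one more on C.
module CyclicGraph (s z a b : ℕ) (a+b≡N : a + b ≡ suc (s + z) + suc (s + z)) (b≡0⊎0<s : b ≡ 0 ⊎ 0 < s) where

  m N : ℕ
  m = suc (s + z)
  N = m + m

  open Modular N

  z≤N∸1 : z ≤ s + z + m
  z≤N∸1 = ≤-trans (m≤n+m z s) (m≤m+n (s + z) m)

  z<N : z < N
  z<N = s≤s z≤N∸1

  s<N : s < N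
  s<N = s≤s (≤-trans (m≤m+n s z) (m≤m+n (s + z) m))

  gap : ℕ → ℕ → ℕ
  gap q q′ = (q′ + (N ∸ suc q)) % N

  ahead : ℕ → ℕ → Bool → Bool
  ahead q q′ v = does (gap q q′ <? z + ind v)

  HH HL LL : ℕ → ℕ → Bool
  HH p p′ = not (does (p ≟ p′))
  HL p q  = does ((p + q + suc m) % N <? s + ind (does (p <? a)))
  LL q q′ = ahead q q′ (does (q′ <? b)) ∨ ahead q′ q (does (q <? b))

  open TwoSided N N HH HL LL public

  gap-self : ∀ {q} → q < N → gap q q ≡ s + z + m
  gap-self {q} q<N = trans (cong (_% N) (suc-injective (m+[n∸m]≡n q<N))) (m<n⇒m%n≡m (n<1+n (s + z + m)))

  gap-sum : ∀ {q q′} → q < N → q′ < N → (gap q q′ + gap q′ q + 2) % N ≡ 0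
  gap-sum {q} {q′} q<N q′<N = begin
    (A % N + B % N + 2) % N      ≡⟨ cong (_% N) (+-assoc (A % N) (B % N) 2) ⟩
    (A % N + (B % N + 2)) % N    ≡⟨ %-absorbˡ A (B % N + 2) ⟩
    (A + (B % N + 2)) % N        ≡⟨ cong (_% N) (solve 3 (λ a b t → a :+ (b :+ t) := b :+ (t :+ a)) refl A (B % N) 2) ⟩
    (B % N + (2 + A)) % N        ≡⟨ %-absorbˡ B (2 + A) ⟩
    (B + (2 + A)) % N
      ≡⟨ cong (_% N) (solve 4 (λ q q′ t t′ → q :+ t′ :+ (con 2 :+ (q′ :+ t)) := (con 1 :+ q :+ t) :+ (con 1 :+ q′ :+ t′))
                              refl q q′ (N ∸ suc q) (N ∸ suc q′)) ⟩
    (suc q + (N ∸ suc q) + (suc q′ + (N ∸ suc q′))) % N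
                                 ≡⟨ cong₂ (λ x y → (x + y) % N) (m+[n∸m]≡n q<N) (m+[n∸m]≡n q′<N) ⟩
    (N + N) % N                  ≡⟨ [m+n]%n≡m%n N N ⟩
    N % N                        ≡⟨ n%n≡0 N ⟩
    0                            ∎
    where
    open ≡-Reasoning
    A = q′ + (N ∸ suc q)
    B = q + (N ∸ suc q′)

  gap-< : ∀ {q q′ v} → ahead q q′ v ≡ true → suc (gap q q′) ≤ z + ind v
  gap-< {q} {q′} {v} = does-true (gap q q′ <? z + ind v)

  -- The two gaps of a pair add up to N − 2 modulo N, so both arcs can be present only
  -- when s = 0 and both ends lie in C, which b ≡ 0 rules out.
  ahead-exclusive : ∀ {q q′} → q < N → q′ < N →
    ahead q q′ (does (q′ <? b)) ≡ true → ahead q′ q (does (q <? b)) ≡ false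
  ahead-exclusive {q} {q′} q<N q′<N fwd with ahead q′ q (does (q <? b)) in bwd
  ... | false = refl
  ... | true  = ⊥-elim (<⇒≱ short (%≡0⇒≥ (gap-sum q<N q′<N) (<-≤-trans (z<s {1}) (m≤n+m 2 (gap q q′ + gap q′ q)))))
    where
    u = does (q <? b)
    v = does (q′ <? b)
    ends : b ≡ 0 ⊎ 0 < s → ind u + ind v < s + s + 2
    ends (inj₁ b≡0) = subst (_< s + s + 2) (sym (cong₂ _+_ (none q) (none q′))) (<-≤-trans (z<s {1}) (m≤n+m 2 (s + s)))
      where
      none : ∀ x → ind (does (x <? b)) ≡ 0
      none x = cong ind (dec-false (x <? b) (λ x<b → n≮0 (subst (x <_) b≡0 x<b)))
    ends (inj₂ 0<s) = ≤-trans (s≤s (+-mono-≤ (ind≤1 u) (ind≤1 v))) (+-monoˡ-≤ 2 (+-mono-≤ 0<s z≤n))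
    short : gap q q′ + gap q′ q + 2 < N
    short = begin-strict
      gap q q′ + gap q′ q + 2       ≡⟨ solve 2 (λ x y → x :+ y :+ con 2 := (con 1 :+ x) :+ (con 1 :+ y)) refl (gap q q′) (gap q′ q) ⟩
      suc (gap q q′) + suc (gap q′ q) ≤⟨ +-mono-≤ (gap-< {q} {q′} {v} fwd) (gap-< {q′} {q} {u} bwd) ⟩
      z + ind v + (z + ind u)       ≡⟨ solve 3 (λ z u v → z :+ v :+ (z :+ u) := z :+ z :+ (u :+ v)) refl z (ind u) (ind v) ⟩
      z + z + (ind u + ind v)       <⟨ +-monoʳ-< (z + z) (ends b≡0⊎0<s) ⟩
      z + z + (s + s + 2)
        ≡⟨ solve 2 (λ s z → z :+ z :+ (s :+ s :+ con 2) := (con 1 :+ (s :+ z)) :+ (con 1 :+ (s :+ z))) refl s z ⟩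
      N                             ∎
      where open ≤-Reasoning

  HH-sym : ∀ {p p′} → p < N → p′ < N → HH p p′ ≡ HH p′ p
  HH-sym {p} {p′} _ _ = cong not (≟-sym p p′)

  LL-sym : ∀ {q q′} → q < N → q′ < N → LL q q′ ≡ LL q′ q
  LL-sym {q} {q′} _ _ = ∨-comm (ahead q q′ (does (q′ <? b))) _

  HH-irrefl : ∀ {p} → p < N → HH p p ≡ false
  HH-irrefl {p} _ = cong not (dec-true (p ≟ p) refl)

  LL-irrefl : ∀ {q} → q < N → LL q q ≡ false
  LL-irrefl {q} q<N = cong (λ x → x ∨ x) not-ahead
    where
    not-ahead : ahead q q (does (q <? b)) ≡ false
    not-ahead = dec-false (gap q q <? z + ind (does (q <? b))) λ lt → <⇒≱ lt (begin
      z + ind (does (q <? b))  ≤⟨ +-monoʳ-≤ z (≤-trans (ind≤1 _) (s≤s z≤n)) ⟩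
      z + m                    ≤⟨ m≤n+m (z + m) s ⟩
      s + (z + m)              ≡⟨ +-assoc s z m ⟨
      s + z + m                ≡⟨ gap-self q<N ⟨
      gap q q                  ∎)
      where open ≤-Reasoning

  open TwoSided.Graphs N N HH HL LL HH-sym LL-sym HH-irrefl LL-irrefl public

  +ind≤N : ∀ {t} v → t ≤ s + z → t + ind v ≤ N
  +ind≤N {t} v t≤s+z = ≤-trans (+-monoʳ-≤ t (ind≤1 v)) (subst (_≤ N) (+-comm 1 t) (s≤s (≤-trans t≤s+z (m≤m+n (s + z) m))))

  degreeH-value : ∀ {p} → p < N → degreeH p ≡ s + z + m + (s + ind (does (p <? a)))
  degreeH-value {p} p<N = cong₂ _+_ clique window
    where
    w = s + ind (does (p <? a))
    clique : ∑[ p′ < N ] ind (not (does (p ≟ p′))) ≡ s + z + m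
    clique = +-cancelʳ-≡ 1 _ (s + z + m) (trans (∑<-≢ p<N) (+-comm 1 (s + z + m)))
    window : ∑[ q < N ] ind (HL p q) ≡ w
    window = begin
      ∑[ q < N ] ind (does ((p + q + suc m) % N <? w))   ≡⟨ ∑<-cong N (λ q _ → cong (λ x → ind (does (x % N <? w)))
                                                              (solve 3 (λ p q c → p :+ q :+ c := q :+ (p :+ c)) refl p q (suc m))) ⟩
      ∑[ q < N ] ind (does ((q + (p + suc m)) % N <? w)) ≡⟨ ∑-rotate (p + suc m) (λ x → ind (does (x <? w))) ⟩
      ∑[ x < N ] ind (does (x <? w))                     ≡⟨ ∑<-lt (+ind≤N (does (p <? a)) (m≤m+n s z)) ⟩
      w                                                  ∎
      where open ≡-Reasoning

  partner : ℕ → ℕ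
  partner q = (q + suc z) % N

  partner<N : ∀ q → partner q < N
  partner<N q = m%n<n (q + suc z) N

  slot : ∀ q → (N ∸ suc (partner q) + (q + suc m)) % N ≡ s
  slot q = begin
    (N ∸ suc y + (q + suc m)) % N
      ≡⟨ cong (_% N) (solve 4 (λ t q s z → t :+ (q :+ (con 2 :+ (s :+ z))) := q :+ (con 1 :+ z) :+ (t :+ (con 1 :+ s)))
                              refl (N ∸ suc y) q s z) ⟩
    (q + suc z + (N ∸ suc y + suc s)) % N        ≡⟨ %-absorbˡ (q + suc z) _ ⟨
    (y + (N ∸ suc y + suc s)) % N
      ≡⟨ cong (_% N) (solve 3 (λ y t s → y :+ (t :+ (con 1 :+ s)) := s :+ ((con 1 :+ y) :+ t)) refl y (N ∸ suc y) s) ⟩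
    (s + (suc y + (N ∸ suc y))) % N              ≡⟨ cong (λ x → (s + x) % N) (m+[n∸m]≡n (partner<N q)) ⟩
    (s + N) % N                                  ≡⟨ [m+n]%n≡m%n s N ⟩
    s % N                                        ≡⟨ m<n⇒m%n≡m s<N ⟩
    s                                            ∎
    where
    open ≡-Reasoning
    y = partner q

  partner-gap : ∀ {q} → q < N → (partner q + (N ∸ suc q)) % N ≡ z
  partner-gap {q} q<N = begin
    ((q + suc z) % N + (N ∸ suc q)) % N       ≡⟨ %-absorbˡ (q + suc z) (N ∸ suc q) ⟩
    (q + suc z + (N ∸ suc q)) % N
      ≡⟨ cong (_% N) (solve 3 (λ q z t → q :+ (con 1 :+ z) :+ t := z :+ ((con 1 :+ q) :+ t)) refl q z (N ∸ suc q)) ⟩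
    (z + (suc q + (N ∸ suc q))) % N           ≡⟨ cong (λ x → (z + x) % N) (m+[n∸m]≡n q<N) ⟩
    (z + N) % N                               ≡⟨ [m+n]%n≡m%n z N ⟩
    z % N                                     ≡⟨ m<n⇒m%n≡m z<N ⟩
    z                                         ∎
    where open ≡-Reasoning

  H-column : ∀ q → ∑[ p < N ] ind (HL p q) ≡ s + ind (does (N ∸ suc (partner q) <? a))
  H-column q = trans (∑<-cong N (λ p _ → cong (λ x → ind (does (x % N <? s + ind (does (p <? a))))) (+-assoc p q (suc m))))
                     (∑-rotate-window (q + suc m) s (λ p → does (p <? a)) s<N (s≤s (m∸n≤m (s + z + m) (partner q))) (slot q))

  forward-row : ∀ {q} → q < N → ∑[ q′ < N ] ind (ahead q q′ (does (q′ <? b))) ≡ z + ind (does (partner q <? b))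
  forward-row {q} q<N = ∑-rotate-window (N ∸ suc q) z (λ q′ → does (q′ <? b)) z<N (partner<N q) (partner-gap q<N)

  backward-row : ∀ {q} u → ∑[ q′ < N ] ind (ahead q′ q u) ≡ z + ind u
  backward-row {q} u = begin
    ∑[ q′ < N ] ind (does ((q + (N ∸ suc q′)) % N <? z + ind u))   ≡⟨ ∑<-reverse N (λ t → ind (does ((q + t) % N <? z + ind u))) ⟩
    ∑[ t < N ] ind (does ((q + t) % N <? z + ind u))
      ≡⟨ ∑<-cong N (λ t _ → cong (λ x → ind (does (x % N <? z + ind u))) (+-comm q t)) ⟩
    ∑[ t < N ] ind (does ((t + q) % N <? z + ind u))               ≡⟨ ∑-rotate q (λ x → ind (does (x <? z + ind u))) ⟩
    ∑[ x < N ] ind (does (x <? z + ind u))                         ≡⟨ ∑<-lt (+ind≤N u (m≤n+m z s)) ⟩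
    z + ind u                                                      ∎
    where open ≡-Reasoning

  reflect-< : ∀ {y} → y < N → ¬ y < b → N ∸ suc y < a
  reflect-< {y} y<N y≮b = +-cancelʳ-< (suc y) (N ∸ suc y) a (begin-strict
    N ∸ suc y + suc y   ≡⟨ m∸n+n≡m y<N ⟩
    N                   ≡⟨ a+b≡N ⟨
    a + b               ≤⟨ +-monoʳ-≤ a (≮⇒≥ y≮b) ⟩
    a + y               <⟨ +-monoʳ-< a (n<1+n y) ⟩
    a + suc y           ∎)
    where open ≤-Reasoning

  reflect-≥ : ∀ {y} → y < b → a ≤ N ∸ suc y
  reflect-≥ {y} y<b = subst (_≤ N ∸ suc y) (trans (cong (_∸ b) (sym a+b≡N)) (m+n∸n≡m a b)) (∸-monoʳ-≤ N y<b)

  reflect-complement : ∀ {y} → y < N → ind (does (N ∸ suc y <? a)) + ind (does (y <? b)) ≡ 1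
  reflect-complement {y} y<N with y <? b
  ... | yes y<b rewrite dec-false (N ∸ suc y <? a) (≤⇒≯ (reflect-≥ y<b)) | dec-true (y <? b) y<b = refl
  ... | no  y≮b rewrite dec-true (N ∸ suc y <? a) (reflect-< y<N y≮b) | dec-false (y <? b) y≮b = refl

  degreeL-value : ∀ {q} → q < N → degreeL q ≡ suc (s + z + z) + ind (does (q <? b))
  degreeL-value {q} q<N = begin
    ∑[ p < N ] ind (HL p q) + ∑[ q′ < N ] ind (LL q q′)
      ≡⟨ cong₂ _+_ (H-column q) (trans (∑<-cong N (λ q′ q′<N → ind-∨ (ahead q q′ (does (q′ <? b))) (ahead q′ q u)
                                                                       (ahead-exclusive q<N q′<N)))
                                       (∑<-distrib N (λ q′ → ind (ahead q q′ (does (q′ <? b)))) (λ q′ → ind (ahead q′ q u)))) ⟩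
    s + ind (does (N ∸ suc (partner q) <? a)) + (∑[ q′ < N ] ind (ahead q q′ (does (q′ <? b))) + ∑[ q′ < N ] ind (ahead q′ q u))
      ≡⟨ cong₂ (λ x y → s + ind (does (N ∸ suc (partner q) <? a)) + (x + y)) (forward-row q<N) (backward-row {q} u) ⟩
    s + P + (z + Y + (z + ind u))
      ≡⟨ solve 5 (λ s p z y u → s :+ p :+ (z :+ y :+ (z :+ u)) := s :+ z :+ z :+ (p :+ y) :+ u) refl s P z Y (ind u) ⟩
    s + z + z + (P + Y) + ind u
      ≡⟨ cong (λ x → s + z + z + x + ind u) (reflect-complement (partner<N q)) ⟩
    s + z + z + 1 + ind u
      ≡⟨ cong (_+ ind u) (+-comm (s + z + z) 1) ⟩
    suc (s + z + z) + ind u ∎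
    where
    open ≡-Reasoning
    u = does (q <? b)
    P = ind (does (N ∸ suc (partner q) <? a))
    Y = ind (does (partner q <? b))

  C-member≤C-nonempty : ∀ q → ind (does (q <? b)) ≤ ind (does (0 <? b))
  C-member≤C-nonempty q with q <? b
  ... | no  q≮b rewrite dec-false (q <? b) q≮b = z≤n
  ... | yes q<b rewrite dec-true (q <? b) q<b | dec-true (0 <? b) (≤-trans (s≤s z≤n) q<b) = ≤-refl

  C-nonempty≤s : b ≡ 0 ⊎ 0 < s → ind (does (0 <? b)) ≤ s
  C-nonempty≤s (inj₁ b≡0) = subst (_≤ s) (sym (cong ind (dec-false (0 <? b) (λ 0<b → n≮0 (subst (0 <_) b≡0 0<b))))) z≤n
  C-nonempty≤s (inj₂ 0<s) = ≤-trans (ind≤1 _) 0<s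

  L-edge : 0 < z ⊎ 0 < b → ∃ λ q → ∃ λ q′ → q < N × q′ < N × LL q q′ ≡ true
  L-edge (inj₁ 0<z) = 0 , 1 , z<s , s≤s (≤-trans (s≤s z≤n) (m≤n+m m (s + z))) ,
    cong (_∨ ahead 1 0 (does (0 <? b))) (trans (cong (λ x → does (x <? z + ind (does (1 <? b)))) (n%n≡0 N))
                                              (dec-true (0 <? z + ind (does (1 <? b))) (≤-trans 0<z (m≤m+n z _))))
  L-edge (inj₂ 0<b) = N ∸ suc z , 0 , s≤s (m∸n≤m (s + z + m) z) , z<s ,
    cong (_∨ ahead 0 (N ∸ suc z) (does (N ∸ suc z <? b))) (begin
      does ((N ∸ suc (N ∸ suc z)) % N <? z + ind (does (0 <? b)))
        ≡⟨ cong (λ x → does (x % N <? z + ind (does (0 <? b)))) (m∸[m∸n]≡n z≤N∸1) ⟩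
      does (z % N <? z + ind (does (0 <? b)))                      ≡⟨ cong (λ x → does (x <? z + ind (does (0 <? b)))) (m<n⇒m%n≡m z<N) ⟩
      does (z <? z + ind (does (0 <? b)))                          ≡⟨ cong (λ x → does (z <? z + ind x)) (dec-true (0 <? b) 0<b) ⟩
      does (z <? z + 1)                                            ≡⟨ dec-true (z <? z + 1) (m<m+n z z<s) ⟩
      true                                                         ∎)
    where open ≡-Reasoning

  ¬selfComplementary : 0 < z ⊎ 0 < b → ∀ {n} (n≡ : n ≡ N + N) → ¬ SelfComplementary (On.graph n n≡)
  ¬selfComplementary 0<z⊎0<b {n} n≡ with L-edge 0<z⊎0<b
  ... | q , q′ , q<N , q′<N , qq′ = H-clique⇒¬selfComplementary (suc (suc X) + c)
    (λ {p} {p′} _ _ p≢p′ → cong not (dec-false (p ≟ p′) p≢p′)) (λ r<N → s≤s (low r<N)) q<N q′<N qq′ (low+t<n q<N) (low+t<n q′<N)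
    where
    open On n n≡
    X = s + z + z
    c = ind (does (0 <? b))
    low : ∀ {r} → r < N → degreeL r ≤ suc X + c
    low {r} r<N = subst (_≤ suc X + c) (sym (degreeL-value r<N)) (+-monoʳ-≤ (suc X) (C-member≤C-nonempty r))
    low+t<n : ∀ {r} → r < N → degreeL r + (suc (suc X) + c) < n
    low+t<n r<N = begin-strict
      degreeL _ + (suc (suc X) + c)   ≤⟨ +-monoˡ-≤ (suc (suc X) + c) (low r<N) ⟩
      suc X + c + (suc (suc X) + c)   ≤⟨ +-mono-≤ (+-monoʳ-≤ (suc X) c≤s) (+-monoʳ-≤ (suc (suc X)) c≤s) ⟩
      suc X + s + (suc (suc X) + s)   <⟨ n<1+n _ ⟩
      suc (suc X + s + (suc (suc X) + s))
        ≡⟨ solve 2 (λ s z → con 1 :+ (con 1 :+ (s :+ z :+ z) :+ s :+ (con 2 :+ (s :+ z :+ z) :+ s))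
                            := (con 1 :+ (s :+ z)) :+ (con 1 :+ (s :+ z)) :+ ((con 1 :+ (s :+ z)) :+ (con 1 :+ (s :+ z)))) refl s z ⟩
      N + N                           ≡⟨ n≡ ⟨
      n                               ∎
      where
      open ≤-Reasoning
      c≤s = C-nonempty≤s b≡0⊎0<s

  ¬forcibly-blocks : 0 < z ⊎ 0 < b →
    ¬ ForciblySelfComplementary ((replicate a (s + z + m + (s + 1)) ++ replicate b (s + z + m + (s + 0)))
                                ++ (replicate b (suc (s + z + z) + 1) ++ replicate a (suc (s + z + z) + 0)))
  ¬forcibly-blocks 0<z⊎0<b =
    ¬forcibly (replicate a (s + z + m + (s + 1)) ++ replicate b (s + z + m + (s + 0)))
              (replicate b (suc (s + z + z) + 1) ++ replicate a (suc (s + z + z) + 0))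
    (trans (length-++ (replicate a _)) (trans (cong₂ _+_ (length-replicate a) (length-replicate b)) a+b≡N))
    (trans (length-++ (replicate b _)) (trans (cong₂ _+_ (length-replicate b) (length-replicate a)) (trans (+-comm b a) a+b≡N)))
    (λ {p} p<N → trans (degreeH-value p<N) (trans (by-cases (λ i → s + z + m + (s + i)) (does (p <? a)))
                   (sym (at-blocks _ _ a b (subst (p <_) (sym a+b≡N) p<N)))))
    (λ {q} q<N → trans (degreeL-value q<N) (trans (by-cases (λ i → suc (s + z + z) + i) (does (q <? b)))
                   (sym (at-blocks _ _ b a (subst (q <_) (sym (trans (+-comm b a) a+b≡N)) q<N)))))
    (¬selfComplementary 0<z⊎0<b)
    where
    by-cases : ∀ (f : ℕ → ℕ) β → f (ind β) ≡ (if β then f 1 else f 0)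
    by-cases f true  = refl
    by-cases f false = refl

module FourBlock (k₁ k₂ : ℕ) where

  m : ℕ
  m = k₁ + k₂

  sequence : ℕ → List ℕ
  sequence d = d ^^ (2 * k₁) ++ (d ∸ 1) ^^ (2 * k₂) ++ (4 * m ∸ d) ^^ (2 * k₂) ++ (4 * m ∸ 1 ∸ d) ^^ (2 * k₁)

  top bottom : ℕ → ℕ
  top d    = 2 * k₁ * d + 2 * k₂ * (d ∸ 1)
  bottom d = 2 * k₂ * (4 * m ∸ d) + 2 * k₁ * (4 * m ∸ 1 ∸ d)

  clique-bound : ℕ
  clique-bound = (2 * k₁ + 2 * k₂) * (2 * k₁ + 2 * k₂ ∸ 1)

  graphic⇒bound : ∀ d → IsDegreeSequence (sequence d) → top d ≤ clique-bound + bottom d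
  graphic⇒bound d graphic = begin
    top d                                        ≡⟨ sum-hs ⟨
    sum hs
      ≤⟨ erdős-gallai-split hs ls (subst IsDegreeSequence (sym (++-assoc (d ^^ (2 * k₁)) _ ls)) graphic) ⟩
    length hs * (length hs ∸ 1) + sum ls         ≡⟨ cong₂ (λ x y → x * (x ∸ 1) + y) length-hs sum-ls ⟩
    clique-bound + bottom d                      ∎
    where
    open ≤-Reasoning
    hs = d ^^ (2 * k₁) ++ (d ∸ 1) ^^ (2 * k₂)
    ls = (4 * m ∸ d) ^^ (2 * k₂) ++ (4 * m ∸ 1 ∸ d) ^^ (2 * k₁)
    sum-hs : sum hs ≡ top d
    sum-hs = trans (sum-++ (d ^^ (2 * k₁)) _) (cong₂ _+_ (sum-replicate (2 * k₁) d) (sum-replicate (2 * k₂) (d ∸ 1)))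
    length-hs : length hs ≡ 2 * k₁ + 2 * k₂
    length-hs = trans (length-++ (d ^^ (2 * k₁))) (cong₂ _+_ (length-replicate (2 * k₁)) (length-replicate (2 * k₂)))
    sum-ls : sum ls ≡ bottom d
    sum-ls = trans (sum-++ ((4 * m ∸ d) ^^ (2 * k₂)) _) (cong₂ _+_ (sum-replicate (2 * k₂) _) (sum-replicate (2 * k₁) _))

  top-mono : ∀ {d d′} → d ≤ d′ → top d ≤ top d′
  top-mono d≤d′ = +-mono-≤ (*-monoʳ-≤ (2 * k₁) d≤d′) (*-monoʳ-≤ (2 * k₂) (∸-monoˡ-≤ 1 d≤d′))

  bottom-anti : ∀ {d d′} → d ≤ d′ → bottom d′ ≤ bottom d
  bottom-anti d≤d′ = +-mono-≤ (*-monoʳ-≤ (2 * k₂) (∸-monoʳ-≤ (4 * m) d≤d′)) (*-monoʳ-≤ (2 * k₁) (∸-monoʳ-≤ (4 * m ∸ 1) d≤d′))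

module _ (j k₂ : ℕ) where
  open FourBlock (suc j) k₂

  -- At d = 3m the right-hand side falls short of top by 4k₁; since top grows and bottom
  -- shrinks with d, this rules out every d ≥ 3m.
  erdős-gallai-fails-at-3m : clique-bound + bottom (3 * m) < top (3 * m)
  erdős-gallai-fails-at-3m = begin-strict
    clique-bound + bottom (3 * m)
      ≡⟨ cong₂ (λ x y → (2 * suc j + 2 * k₂) * x + y) width (cong₂ (λ x y → 2 * k₂ * x + 2 * suc j * y) C-entry D-entry) ⟩
    (2 * suc j + 2 * k₂) * (2 * (j + k₂) + 1) + (2 * k₂ * m + 2 * suc j * (j + k₂))
      <⟨ m<m+n _ (≤-trans (s≤s z≤n) (m≤m+n (suc j) _)) ⟩
    (2 * suc j + 2 * k₂) * (2 * (j + k₂) + 1) + (2 * k₂ * m + 2 * suc j * (j + k₂)) + 4 * suc j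
      ≡⟨ solve 2 (λ j k → (con 2 :* (con 1 :+ j) :+ con 2 :* k) :* (con 2 :* (j :+ k) :+ con 1)
                          :+ (con 2 :* k :* (con 1 :+ j :+ k) :+ con 2 :* (con 1 :+ j) :* (j :+ k)) :+ con 4 :* (con 1 :+ j)
                          := con 2 :* (con 1 :+ j) :* (con 3 :* (con 1 :+ j :+ k)) :+ con 2 :* k :* (con 3 :* (j :+ k) :+ con 2))
                 refl j k₂ ⟩
    2 * suc j * (3 * m) + 2 * k₂ * (3 * (j + k₂) + 2)
      ≡⟨ cong (λ x → 2 * suc j * (3 * m) + 2 * k₂ * x) B-entry ⟨
    top (3 * m) ∎
    where
    open ≤-Reasoning
    width : 2 * suc j + 2 * k₂ ∸ 1 ≡ 2 * (j + k₂) + 1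
    width = cong (_∸ 1) (solve 2 (λ j k → con 2 :* (con 1 :+ j) :+ con 2 :* k := con 1 :+ (con 2 :* (j :+ k) :+ con 1)) refl j k₂)
    B-entry : 3 * m ∸ 1 ≡ 3 * (j + k₂) + 2
    B-entry = cong (_∸ 1) (solve 2 (λ j k → con 3 :* (con 1 :+ j :+ k) := con 1 :+ (con 3 :* (j :+ k) :+ con 2)) refl j k₂)
    C-entry : 4 * m ∸ 3 * m ≡ m
    C-entry = trans (cong (_∸ 3 * m) (solve 1 (λ m → con 4 :* m := con 3 :* m :+ m) refl m)) (m+n∸m≡n (3 * m) m)
    D-entry : 4 * m ∸ 1 ∸ 3 * m ≡ j + k₂
    D-entry = trans (cong (λ x → x ∸ 1 ∸ 3 * m)
                          (solve 2 (λ j k → con 4 :* (con 1 :+ j :+ k) := con 1 :+ (con 3 :* (con 1 :+ j :+ k) :+ (j :+ k))) refl j k₂))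
                    (m+n∸m≡n (3 * m) (j + k₂))

  four-block-shape : ∀ d → m + m ≤ d → top d ≤ clique-bound + bottom d → ∃ λ s → ∃ λ z → m ≡ suc (s + z) × d ≡ m + m + s
  four-block-shape d 2m≤d bound with d ∸ (m + m) <? m
  ... | yes s<m = d ∸ (m + m) , m ∸ suc (d ∸ (m + m)) , sym (m+[n∸m]≡n s<m) , sym (m+[n∸m]≡n 2m≤d)
  ... | no  s≮m = ⊥-elim (<⇒≱ erdős-gallai-fails-at-3m (begin
    top (3 * m)                       ≤⟨ top-mono 3m≤d ⟩
    top d                             ≤⟨ bound ⟩
    clique-bound + bottom d           ≤⟨ +-monoʳ-≤ clique-bound (bottom-anti 3m≤d) ⟩
    clique-bound + bottom (3 * m)     ∎))
    where
    open ≤-Reasoning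
    3m≤d : 3 * m ≤ d
    3m≤d = subst₂ _≤_ (solve 1 (λ m → m :+ m :+ m := con 3 :* m) refl m) (m+[n∸m]≡n 2m≤d)
                  (+-monoʳ-≤ (m + m) (≮⇒≥ s≮m))

above-middle : ∀ m d → 4 * m ∸ d < d ∸ 1 → m + m < d
above-middle m d low = ≰⇒> λ d≤2m → <⇒≱ low (begin
  d ∸ 1               ≤⟨ m∸n≤m d 1 ⟩
  d                   ≤⟨ d≤2m ⟩
  m + m               ≡⟨ trans (cong (_∸ (m + m)) (solve 1 (λ m → con 4 :* m := (m :+ m) :+ (m :+ m)) refl m)) (m+n∸m≡n (m + m) (m + m)) ⟨
  4 * m ∸ (m + m)     ≤⟨ ∸-monoʳ-≤ (4 * m) d≤2m ⟩
  4 * m ∸ d           ∎)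
  where open ≤-Reasoning

at-least-middle : ∀ k d → 4 * k ∸ 1 ∸ d < d → k + k ≤ d
at-least-middle k d high = ≮⇒≥ λ d<2k → <⇒≱ high (m+n≤o⇒m≤o∸n d (∸-monoˡ-≤ 1 (begin
  suc (d + d)         ≤⟨ +-mono-< d<2k d<2k ⟩
  k + k + (k + k)     ≡⟨ solve 1 (λ k → k :+ k :+ (k :+ k) := con 4 :* k) refl k ⟩
  4 * k               ∎)))
  where open ≤-Reasoning

replicate-+ : ∀ m n (x : ℕ) → replicate (m + n) x ≡ replicate m x ++ replicate n x
replicate-+ zero    n x = refl
replicate-+ (suc m) n x = cong (x ∷_) (replicate-+ m n x)

¬forcibly-resp : ∀ {s s′} → s ≡ s′ → ¬ ForciblySelfComplementary s′ → ¬ ForciblySelfComplementary s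
¬forcibly-resp refl ¬fsc = ¬fsc

four-block-¬forcibly : ∀ k₁ k₂ {d} s z → k₁ + k₂ ≡ suc (s + z) → d ≡ (k₁ + k₂) + (k₁ + k₂) + s →
  2 * k₂ ≡ 0 ⊎ 0 < s → 0 < z ⊎ 0 < 2 * k₂ → ¬ ForciblySelfComplementary (FourBlock.sequence k₁ k₂ d)
four-block-¬forcibly k₁ k₂ {d} s z m≡ d≡ b≡0⊎0<s 0<z⊎0<b =
  ¬forcibly-resp (regroup (values m≡ d≡))
    (CyclicGraph.¬forcibly-blocks s z (2 * k₁) (2 * k₂) a+b≡N b≡0⊎0<s 0<z⊎0<b)
  where
  M = suc (s + z)
  a+b≡N : 2 * k₁ + 2 * k₂ ≡ M + M
  a+b≡N = trans (solve 2 (λ x y → con 2 :* x :+ con 2 :* y := (x :+ y) :+ (x :+ y)) refl k₁ k₂) (cong₂ _+_ m≡ m≡)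
  values : ∀ {m d} → m ≡ M → d ≡ m + m + s →
    (d ≡ s + z + M + (s + 1)) × (d ∸ 1 ≡ s + z + M + (s + 0)) ×
    (4 * m ∸ d ≡ suc (s + z + z) + 1) × (4 * m ∸ 1 ∸ d ≡ suc (s + z + z) + 0)
  values refl refl = A≡ , B≡ , C≡ , D≡
    where
    d₀ = M + M + s
    A≡ : d₀ ≡ s + z + M + (s + 1)
    A≡ = solve 2 (λ s z → (con 1 :+ (s :+ z)) :+ (con 1 :+ (s :+ z)) :+ s := s :+ z :+ (con 1 :+ (s :+ z)) :+ (s :+ con 1)) refl s z
    B≡ : d₀ ∸ 1 ≡ s + z + M + (s + 0)
    B≡ = solve 2 (λ s z → s :+ z :+ (con 1 :+ (s :+ z)) :+ s := s :+ z :+ (con 1 :+ (s :+ z)) :+ (s :+ con 0)) refl s z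
    C≡ : 4 * M ∸ d₀ ≡ suc (s + z + z) + 1
    C≡ = trans (cong (_∸ d₀) (solve 2 (λ s z → con 4 :* (con 1 :+ (s :+ z))
                                         := (con 1 :+ (s :+ z)) :+ (con 1 :+ (s :+ z)) :+ s :+ (con 1 :+ (s :+ z :+ z) :+ con 1))
                                     refl s z))
               (m+n∸m≡n d₀ _)
    D≡ : 4 * M ∸ 1 ∸ d₀ ≡ suc (s + z + z) + 0
    D≡ = trans (∸-+-assoc (4 * M) 1 d₀)
               (trans (cong (_∸ (1 + d₀)) (solve 2 (λ s z → con 4 :* (con 1 :+ (s :+ z))
                                                      := con 1 :+ ((con 1 :+ (s :+ z)) :+ (con 1 :+ (s :+ z)) :+ s)
                                                         :+ (con 1 :+ (s :+ z :+ z) :+ con 0))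
                                                  refl s z))
                      (m+n∸m≡n (1 + d₀) _))
  regroup : ∀ {A B C D A′ B′ C′ D′} → (A ≡ A′) × (B ≡ B′) × (C ≡ C′) × (D ≡ D′) →
    A ^^ (2 * k₁) ++ B ^^ (2 * k₂) ++ C ^^ (2 * k₂) ++ D ^^ (2 * k₁) ≡
    (replicate (2 * k₁) A′ ++ replicate (2 * k₂) B′) ++ (replicate (2 * k₂) C′ ++ replicate (2 * k₁) D′)
  regroup (refl , refl , refl , refl) = sym (++-assoc (replicate (2 * k₁) _) _ _)

constant-¬forcibly : ∀ k → 2 ≤ k → ¬ ForciblySelfComplementary ((2 * k) ^^ (4 * k + 1))
constant-¬forcibly k 2≤k = ¬forcibly-resp
  (trans (cong₂ (λ n x → replicate n x) (solve 1 (λ k → con 4 :* k :+ con 1 := (k :+ k) :+ (k :+ k :+ con 1)) refl k)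
                                         (solve 1 (λ k → con 2 :* k := k :+ k) refl k))
         (replicate-+ (k + k) (k + k + 1) (k + k)))
  (RegularGraph.¬forcibly-regular k 2≤k)

extremal-two-valued-¬forcibly : ∀ s {d} → 2 ≤ s → d ≡ (suc s + 0) + (suc s + 0) + s →
  ¬ ForciblySelfComplementary (d ^^ (2 * suc s) ++ (4 * suc s ∸ 1 ∸ d) ^^ (2 * suc s))
extremal-two-valued-¬forcibly s 2≤s refl = ¬forcibly-resp
  (cong₂ _++_ (cong₂ (λ n x → replicate n x) length≡ high≡) (cong₂ (λ n x → replicate n x) length≡ low≡))
  (TwinGraph.¬forcibly-twin s 2≤s)
  where
  d = (suc s + 0) + (suc s + 0) + s
  length≡ : 2 * suc s ≡ suc s + suc s
  length≡ = solve 1 (λ s → con 2 :* (con 1 :+ s) := (con 1 :+ s) :+ (con 1 :+ s)) refl s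
  high≡ : d ≡ s + suc s + suc s
  high≡ = solve 1 (λ s → (con 1 :+ s :+ con 0) :+ (con 1 :+ s :+ con 0) :+ s := s :+ (con 1 :+ s) :+ (con 1 :+ s)) refl s
  low≡ : 4 * suc s ∸ 1 ∸ d ≡ suc s
  low≡ = trans (∸-+-assoc (4 * suc s) 1 d)
               (trans (cong (_∸ (1 + d)) (solve 1 (λ s → con 4 :* (con 1 :+ s)
                                                     := con 1 :+ ((con 1 :+ s :+ con 0) :+ (con 1 :+ s :+ con 0) :+ s) :+ (con 1 :+ s))
                                                 refl s))
                      (m+n∸m≡n (1 + d) (suc s)))

two-valued≡four-block : ∀ k d → d ^^ (2 * k) ++ (4 * k ∸ 1 ∸ d) ^^ (2 * k) ≡ FourBlock.sequence k 0 d
two-valued≡four-block k d = cong (λ x → d ^^ (2 * k) ++ (4 * x ∸ 1 ∸ d) ^^ (2 * k)) (sym (+-identityʳ k))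

two-valued-shape-¬forcibly : ∀ j d → 2 ≤ suc j → d ≢ 5 →
  (∃ λ s → ∃ λ z → suc j + 0 ≡ suc (s + z) × d ≡ (suc j + 0) + (suc j + 0) + s) →
  ¬ ForciblySelfComplementary (d ^^ (2 * suc j) ++ (4 * suc j ∸ 1 ∸ d) ^^ (2 * suc j))
two-valued-shape-¬forcibly j d _ _ (s , suc z , m≡ , d≡) =
  ¬forcibly-resp (two-valued≡four-block (suc j) d) (four-block-¬forcibly (suc j) 0 s (suc z) m≡ d≡ (inj₁ refl) (inj₁ z<s))
two-valued-shape-¬forcibly j d 2≤k d≢5 (s , zero , m≡ , d≡)
  with suc-injective (trans (sym (+-identityʳ (suc j))) (trans m≡ (cong suc (+-identityʳ s))))
... | refl with s
...   | zero         = ⊥-elim (<⇒≱ 2≤k (s≤s z≤n))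
...   | suc zero     = ⊥-elim (d≢5 d≡)
...   | suc (suc s′) = extremal-two-valued-¬forcibly (suc (suc s′)) (s≤s (s≤s z≤n)) d≡

two-valued-¬forcibly : ∀ k d → 2 ≤ k → d ≢ 5 → 4 * k ∸ 1 ∸ d < d →
  IsDegreeSequence (d ^^ (2 * k) ++ (4 * k ∸ 1 ∸ d) ^^ (2 * k)) →
  ¬ ForciblySelfComplementary (d ^^ (2 * k) ++ (4 * k ∸ 1 ∸ d) ^^ (2 * k))
two-valued-¬forcibly (suc j) d 2≤k d≢5 high graphic = two-valued-shape-¬forcibly j d 2≤k d≢5
  (four-block-shape j 0 d (subst (_≤ d) (sym (cong₂ _+_ (+-identityʳ (suc j)) (+-identityʳ (suc j)))) (at-least-middle (suc j) d high))
               (FourBlock.graphic⇒bound (suc j) 0 d (subst IsDegreeSequence (two-valued≡four-block (suc j) d) graphic)))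

four-valued-shape-¬forcibly : ∀ k₁ k₂ d → 0 < k₂ → k₁ + k₂ + (k₁ + k₂) < d →
  (∃ λ s → ∃ λ z → k₁ + k₂ ≡ suc (s + z) × d ≡ (k₁ + k₂) + (k₁ + k₂) + s) →
  ¬ ForciblySelfComplementary (FourBlock.sequence k₁ k₂ d)
four-valued-shape-¬forcibly k₁ k₂ d 0<k₂ 2m<d (s , z , m≡ , d≡) =
  four-block-¬forcibly k₁ k₂ s z m≡ d≡ (inj₂ 0<s) (inj₂ (≤-trans 0<k₂ (m≤m+n k₂ _)))
  where
  0<s : 0 < s
  0<s = +-cancelˡ-< (k₁ + k₂ + (k₁ + k₂)) 0 s (subst₂ _<_ (sym (+-identityʳ _)) d≡ 2m<d)

four-valued-¬forcibly : ∀ k₁ k₂ d → 0 < k₁ → 0 < k₂ → 4 * (k₁ + k₂) ∸ d < d ∸ 1 →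
  IsDegreeSequence (FourBlock.sequence k₁ k₂ d) → ¬ ForciblySelfComplementary (FourBlock.sequence k₁ k₂ d)
four-valued-¬forcibly (suc j) k₂ d _ 0<k₂ low graphic = four-valued-shape-¬forcibly (suc j) k₂ d 0<k₂ (above-middle (suc j + k₂) d low)
  (four-block-shape j k₂ d (<⇒≤ (above-middle (suc j + k₂) d low)) (FourBlock.graphic⇒bound (suc j) k₂ d graphic))

proposition15 : (∀ (k : ℕ) → 2 ≤ k →
    IsDegreeSequence ((2 * k) ^^ (4 * k + 1)) →
    ¬ ForciblySelfComplementary ((2 * k) ^^ (4 * k + 1)))
    × (∀ (k d : ℕ) → 2 ≤ k → d ≢ 5 → 4 * k ∸ 1 ∸ d < d →
    IsDegreeSequence (d ^^ (2 * k) ++ (4 * k ∸ 1 ∸ d) ^^ (2 * k)) →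
    ¬ ForciblySelfComplementary (d ^^ (2 * k) ++ (4 * k ∸ 1 ∸ d) ^^ (2 * k)))
    × (∀ (k₁ k₂ d : ℕ) → 0 < k₁ → 0 < k₂ → 4 * (k₁ + k₂) ∸ d < d ∸ 1 →
    IsDegreeSequence
    (d ^^ (2 * k₁) ++ (d ∸ 1) ^^ (2 * k₂)
    ++ (4 * (k₁ + k₂) ∸ d) ^^ (2 * k₂)
    ++ (4 * (k₁ + k₂) ∸ 1 ∸ d) ^^ (2 * k₁)) →
    ¬ ForciblySelfComplementary
    (d ^^ (2 * k₁) ++ (d ∸ 1) ^^ (2 * k₂)
    ++ (4 * (k₁ + k₂) ∸ d) ^^ (2 * k₂)
    ++ (4 * (k₁ + k₂) ∸ 1 ∸ d) ^^ (2 * k₁)))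
proposition15 = (λ k 2≤k _ → constant-¬forcibly k 2≤k) , two-valued-¬forcibly , four-valued-¬forcibly
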